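{- Let $p$ be a prime, $\ell\ge1$, and $k>\ell$, $0\le m\le k-\ell-1$. Let $s$ with $p^k\le s<p^{k+1}$ have base-$p$ expansion $$s=\lfloor b_k\cdots b_{k-m}\underbrace{(p-1)\cdots(p-1)}_{\ell}b_{k-m-\ell-1}\cdots b_0\rfloor_p,$$ and let $$s'=\lfloor b_k\cdots b_{k-m}\underbrace{(p-1)\cdots(p-1)}_{\ell-1}b_{k-m-\ell-1}\cdots b_0\rfloor_p.$$ Then $\mathrm{bin}_s\equiv_\nu\mathrm{A}(\mathrm{bin}_{s'},p^{k-m-\ell})$. In particular, $\Pi_i(\mathrm{bin}_s)=\Pi_i(\mathrm{bin}_{s'})$ for every $0\le i<\ell$, and $Z(\mathrm{bin}_s)=Z(\mathrm{bin}_{s'})+(p-1)p^{k+\ell-1}$.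
   Context: $\mathrm{bin}_s:\mathbb{N}\to\mathbb{Z}_{p^\ell}$ is $n\mapsto\binom ns \bmod p^\ell$, a periodic sequence. $\lfloor a_r\cdots a_0\rfloor_p=\sum a_ip^i$ with digits $0\le a_i<p$. For $t\ge1$ and a sequence $f$, let $h_j=(f(jp^t),\dots,f((j+1)p^t-1))$; then $\mathrm{A}(f,p^t)=(0,\dots,0,h_0,0,\dots,0,h_1,\dots)$, with each $h_j$ preceded by $(p-1)p^t$ zeros. On $\mathbb{Z}_{p^\ell}$, $\nu_p$ is the $p$-adic valuation of a representative of a non-zero class. For periodic $f,g$, $f\equiv_\nu g$ means: for all $n$, $f(n)=0$ iff $g(n)=0$, and otherwise $\nu_p(f(n))=\nu_p(g(n))$. For periodic $f$ of minimal period $\tau(f)$, $\Pi_i(f)$ is the number of $x\in\{0,\dots,\tau(f)-1\}$ with $\nu_p(f(x))=i$, and $Z(f)$ is the number of such $x$ with $f(x)=0$. -}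

module Defs where

open import Data.Nat using (ℕ; zero; suc; _+_; _*_; _∸_; _^_; _≤_; _<_; _<ᵇ_)
open import Data.Nat.DivMod using (_/_; _%_)
open import Data.Nat.Combinatorics using (_C_)
open import Data.Nat.Divisibility using (_∣_; _∣?_)
open import Data.List using (List; foldl)
open import Data.Bool using (if_then_else_)
open import Data.Product using (_×_)
open import Relation.Nullary using (¬_; Dec; yes; no; _×-dec_; ¬?)
open import Relation.Binary.PropositionalEquality using (_≡_; _≢_)
open import Function.Bundles using (_⇔_)
import Data.Nat as N

-- Division / remainder with an explicit (irrelevant) convention for divisor 0.
-- In all uses below the divisor is a positive power of a prime.
_%′_ : ℕ → ℕ → ℕ
x %′ zero  = x
x %′ suc d = x % suc d

_/′_ : ℕ → ℕ → ℕ
x /′ zero  = zero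
x /′ suc d = x / suc d

-- ⌊ a_r ⋯ a_0 ⌋_p : digits listed most significant first.
⌊_⌋ : List ℕ → ℕ → ℕ
⌊ ds ⌋ p = foldl (λ acc a → acc * p + a) 0 ds

-- bin_s : ℕ → ℤ/p^ℓ, n ↦ (n choose s) mod p^ℓ; elements of ℤ/p^ℓ are
-- represented by their canonical representatives in {0,…,p^ℓ-1}.
bin : (p ℓ s : ℕ) → ℕ → ℕ
bin p ℓ s n = (n C s) %′ (p ^ ℓ)

-- A(f, p^t): blocks of length p^(t+1); in block j the first (p-1)p^t entries
-- are 0 and the remaining p^t entries are h_j = (f(j p^t), …, f((j+1)p^t - 1)).
A : (p t : ℕ) → (ℕ → ℕ) → ℕ → ℕ
A p t f n =
  let B = p ^ suc t
      j = n /′ B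
      r = n %′ B
      z = (p ∸ 1) * p ^ t
  in if r <ᵇ z then 0 else f (j * p ^ t + (r ∸ z))

HasVal : (p i x : ℕ) → Set
HasVal p i x = (p ^ i ∣ x) × ¬ (p ^ suc i ∣ x)

hasVal? : (p i x : ℕ) → Dec (HasVal p i x)
hasVal? p i x = (p ^ i ∣? x) ×-dec ¬? (p ^ suc i ∣? x)

_≡ν[_]_ : (ℕ → ℕ) → ℕ → (ℕ → ℕ) → Set
f ≡ν[ p ] g = ∀ n → ((f n ≡ 0) ⇔ (g n ≡ 0))
                  × (f n ≢ 0 → ∀ i → HasVal p i (f n) ⇔ HasVal p i (g n))

IsPeriod : (ℕ → ℕ) → ℕ → Set
IsPeriod f τ = (0 < τ) × (∀ n → f (n + τ) ≡ f n)

IsMinPeriod : (ℕ → ℕ) → ℕ → Set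
IsMinPeriod f τ = IsPeriod f τ × (∀ τ′ → IsPeriod f τ′ → τ ≤ τ′)

count : (n : ℕ) → (P : ℕ → Set) → ((x : ℕ) → Dec (P x)) → ℕ
count zero    P P? = 0
count (suc n) P P? with P? n
... | yes _ = suc (count n P P?)
... | no  _ = count n P P?

-- Π_i(f) and Z(f), given the minimal period τ of f
Π : (p i τ : ℕ) → (ℕ → ℕ) → ℕ
Π p i τ f = count τ (λ x → ¬ (f x ≡ 0) × HasVal p i (f x))
                    (λ x → ¬? (f x N.≟ 0) ×-dec hasVal? p i (f x))

Z : (τ : ℕ) → (ℕ → ℕ) → ℕ
Z τ f = count τ (λ x → f x ≡ 0) (λ x → f x N.≟ 0)

module Submission where

-- By Kummer's theorem ν_p(C(n, s)) is the number of carries in the base-p addition s + (n − s).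
-- Write n = R + (a + Q p) p^t with R < p^t, a < p and t = k − m − ℓ, so that a faces the lowest of
-- the ℓ digits p − 1 of s. If a < p − 1, a carry must leave that digit and then runs through the
-- other ℓ − 1 digits p − 1, so p^ℓ divides C(n, s): these n are the zeros that A inserts. If a = p − 1,
-- either a carry leaves the low t digits, and then both C(n, s) and C(R + Q p^t, s′) are divisible by
-- p^ℓ, or no carry reaches digit t, and deleting digit t from s and from n keeps every carry.
-- The counts follow since bin_s and bin_s′ have minimal periods p^(k+ℓ) and p^(k+ℓ−1), and A spreads
-- each block of p^t values of bin_s′ over p^(t+1) values, adding (p − 1) p^t zeros.

open import Defs
open import Data.Bool using (true; false; if_then_else_)
open import Data.Empty using (⊥-elim)
open import Data.List using (List; []; _∷_; _++_; replicate; length; foldl)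
open import Data.List.Properties using (foldl-++; length-++; length-replicate)
open import Data.List.Relation.Unary.All using (All; []; _∷_)
open import Data.Nat
open import Data.Nat.Combinatorics using (_C_; nCk≡n!/k![n-k]!; k![n∸k]!∣n!; k>n⇒nCk≡0; nCk+nC[k+1]≡[n+1]C[k+1])
open import Data.Nat.Coprimality using (Coprime; coprime-divisor)
open import Data.Nat.Divisibility
open import Data.Nat.DivMod
open import Data.Nat.Induction using (<-rec)
open import Data.Nat.Primality using (Prime; prime⇒nonZero; prime⇒nonTrivial; prime⇒irreducible; euclidsLemma)
open import Data.Nat.Properties
open import Data.Nat.Tactic.RingSolver using (solve-∀)
open import Data.Product
open import Data.Sum using (_⊎_; inj₁; inj₂)
open import Function.Bundles using (_⇔_; mk⇔; Equivalence)
open import Relation.Binary.Definitions using (tri<; tri≈; tri>)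
open import Relation.Binary.PropositionalEquality
open import Relation.Nullary hiding (⌊_⌋)

%′≡% : ∀ d .{{_ : NonZero d}} x → x %′ d ≡ x % d
%′≡% (suc d) x = refl

/′≡/ : ∀ d .{{_ : NonZero d}} x → x /′ d ≡ x / d
/′≡/ (suc d) x = refl

module _ {d : ℕ} .{{_ : NonZero d}} where

  [r+q*d]/d≡q : ∀ r q → r < d → (r + q * d) / d ≡ q
  [r+q*d]/d≡q r q r<d = begin
      (r + q * d) / d     ≡⟨ +-distrib-/ r (q * d) r%d+qd%d<d ⟩
      r / d + q * d / d   ≡⟨ cong₂ _+_ (m<n⇒m/n≡0 r<d) (m*n/n≡m q d) ⟩
      q                   ∎
    where
    open ≡-Reasoning
    r%d+qd%d<d : r % d + (q * d) % d < d
    r%d+qd%d<d = subst (_< d) (sym (trans (cong₂ _+_ (m<n⇒m%n≡m r<d) (m*n%n≡0 q d)) (+-identityʳ r))) r<d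

  [r+q*d]%d≡r : ∀ r q → r < d → (r + q * d) % d ≡ r
  [r+q*d]%d≡r r q r<d = trans ([m+kn]%n≡m%n r q d) (m<n⇒m%n≡m r<d)

  divMod-unique : ∀ r r′ q q′ → r < d → r′ < d → r + q * d ≡ r′ + q′ * d → r ≡ r′ × q ≡ q′
  divMod-unique r r′ q q′ r<d r′<d eq =
      trans (sym ([r+q*d]%d≡r r q r<d)) (trans (cong (_% d) eq) ([r+q*d]%d≡r r′ q′ r′<d))
    , trans (sym ([r+q*d]/d≡q r q r<d)) (trans (cong (_/ d) eq) ([r+q*d]/d≡q r′ q′ r′<d))

module Valuation {p : ℕ} (p-prime : Prime p) where

  instance
    p≢0 : NonZero p
    p≢0 = prime⇒nonZero p-prime

  p^≢0 : ∀ n → NonZero (p ^ n)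
  p^≢0 n = m^n≢0 p n

  1<p : 1 < p
  1<p = nonTrivial⇒n>1 p {{prime⇒nonTrivial p-prime}}

  p∤1 : p ∤ 1
  p∤1 p∣1 = <⇒≱ 1<p (∣⇒≤ p∣1)

  p∤-* : ∀ {u v} → p ∤ u → p ∤ v → p ∤ u * v
  p∤-* {u} {v} p∤u p∤v p∣uv with euclidsLemma u v p-prime p∣uv
  ... | inj₁ p∣u = p∤u p∣u
  ... | inj₂ p∣v = p∤v p∣v

  p^-∣-p^ : ∀ {a b} → a ≤ b → p ^ a ∣ p ^ b
  p^-∣-p^ {a} {b} a≤b = divides (p ^ (b ∸ a)) (begin
      p ^ b               ≡⟨ cong (p ^_) (sym (m∸n+n≡m a≤b)) ⟩
      p ^ (b ∸ a + a)     ≡⟨ ^-distribˡ-+-* p (b ∸ a) a ⟩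
      p ^ (b ∸ a) * p ^ a ∎)
    where open ≡-Reasoning

  record Val (x v : ℕ) : Set where
    constructor val
    field
      cofactor   : ℕ
      factorised : x ≡ p ^ v * cofactor
      p∤cofactor : p ∤ cofactor

  Val-unique : ∀ {x a b} → Val x a → Val x b → a ≡ b
  Val-unique (val u x≡ p∤u) (val w x≡′ p∤w) = exponents (trans (sym x≡) x≡′)
    where
    p∣p^[1+c]*z : ∀ c z → p ∣ p ^ suc c * z
    p∣p^[1+c]*z c z = ∣-trans (divides (p ^ c) (*-comm p (p ^ c))) (m∣m*n z)
    exponents : ∀ {a b} → p ^ a * u ≡ p ^ b * w → a ≡ b
    exponents {zero}  {zero}  _  = refl
    exponents {zero}  {suc b} eq = ⊥-elim (p∤u (subst (p ∣_) (trans (sym eq) (*-identityˡ u)) (p∣p^[1+c]*z b w)))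
    exponents {suc a} {zero}  eq = ⊥-elim (p∤w (subst (p ∣_) (trans eq (*-identityˡ w)) (p∣p^[1+c]*z a u)))
    exponents {suc a} {suc b} eq = cong suc (exponents (*-cancelˡ-≡ (p ^ a * u) (p ^ b * w) p
      (trans (sym (*-assoc p (p ^ a) u)) (trans eq (*-assoc p (p ^ b) w)))))

  Val-* : ∀ {x y a b} → Val x a → Val y b → Val (x * y) (a + b)
  Val-* {x} {y} {a} {b} (val u x≡ p∤u) (val w y≡ p∤w) = val (u * w) xy≡ (p∤-* p∤u p∤w)
    where
    regroup : ∀ A B u w → A * u * (B * w) ≡ A * B * (u * w)
    regroup = solve-∀
    xy≡ : x * y ≡ p ^ (a + b) * (u * w)
    xy≡ = trans (cong₂ _*_ x≡ y≡) (trans (regroup (p ^ a) (p ^ b) u w)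
            (cong (_* (u * w)) (sym (^-distribˡ-+-* p a b))))

  Val-∤ : ∀ {x} → p ∤ x → Val x 0
  Val-∤ {x} p∤x = val x (sym (+-identityʳ x)) p∤x

  Val-p : Val p 1
  Val-p = val 1 (sym (trans (*-identityʳ _) (*-identityʳ p))) p∤1

  Val-exists : ∀ x → x ≢ 0 → ∃ (Val x)
  Val-exists = <-rec (λ x → x ≢ 0 → ∃ (Val x)) step
    where
    step : ∀ x → (∀ {y} → y < x → y ≢ 0 → ∃ (Val y)) → x ≢ 0 → ∃ (Val x)
    step x rec x≢0 with p ∣? x
    ... | no p∤x = 0 , Val-∤ p∤x
    ... | yes (divides q x≡q*p) with rec q<x q≢0
      where
      q≢0 : q ≢ 0
      q≢0 refl = x≢0 x≡q*p
      q<x : q < x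
      q<x = subst (q <_) (sym x≡q*p) (m<m*n q p {{≢-nonZero q≢0}} 1<p)
    ... | e , val u q≡ p∤u = suc e , val u x≡ p∤u
      where
      x≡ : x ≡ p ^ suc e * u
      x≡ = trans x≡q*p (trans (cong (_* p) q≡)
             (trans (*-comm (p ^ e * u) p) (sym (*-assoc p (p ^ e) u))))

  Val⇒HasVal : ∀ {x v} → Val x v → HasVal p v x
  Val⇒HasVal {x} {v} (val u x≡ p∤u) =
      divides u (trans x≡ (*-comm (p ^ v) u))
    , λ p^v⁺¹∣x → p∤u (*-cancelˡ-∣ (p ^ v) {{p^≢0 v}} (subst (_∣ p ^ v * u) (*-comm p (p ^ v)) (subst (p ^ suc v ∣_) x≡ p^v⁺¹∣x)))

  HasVal⇒≡ : ∀ {x v i} → Val x v → HasVal p i x → i ≡ v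
  HasVal⇒≡ {v = v} {i} x-val (p^i∣x , p^i⁺¹∤x) with <-cmp i v
  ... | tri≈ _ i≡v _ = i≡v
  ... | tri< i<v _ _ = ⊥-elim (p^i⁺¹∤x (∣-trans (p^-∣-p^ i<v) (proj₁ (Val⇒HasVal x-val))))
  ... | tri> _ _ v<i = ⊥-elim (proj₂ (Val⇒HasVal x-val) (∣-trans (p^-∣-p^ v<i) p^i∣x))

  p∤∧∣p^⇒≡1 : ∀ N {w} → p ∤ w → w ∣ p ^ N → w ≡ 1
  p∤∧∣p^⇒≡1 zero    _   w∣1 = ∣1⇒≡1 w∣1
  p∤∧∣p^⇒≡1 (suc N) {w} p∤w w∣ = p∤∧∣p^⇒≡1 N p∤w (coprime-divisor w⊥p w∣)
    where
    w⊥p : Coprime w p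
    w⊥p (i∣w , i∣p) with prime⇒irreducible p-prime i∣p
    ... | inj₁ i≡1 = i≡1
    ... | inj₂ refl = ⊥-elim (p∤w i∣w)

  ∣p^⇒≡p^ : ∀ N {d} → d ∣ p ^ N → ∃ λ v → v ≤ N × d ≡ p ^ v
  ∣p^⇒≡p^ N {d} d∣p^N with Val-exists d d≢0
    where
    d≢0 : d ≢ 0
    d≢0 refl = ≢-nonZero⁻¹ (p ^ N) {{p^≢0 N}} (0∣⇒≡0 d∣p^N)
  ... | v , val w d≡ p∤w = v , v≤N , d≡p^v
    where
    d≡p^v : d ≡ p ^ v
    d≡p^v = trans d≡ (trans (cong (p ^ v *_) (p∤∧∣p^⇒≡1 N p∤w (∣-trans (divides (p ^ v) d≡) d∣p^N))) (*-identityʳ _))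
    v≤N : v ≤ N
    v≤N = ≮⇒≥ λ N<v → <⇒≱ (^-monoʳ-< p 1<p N<v) (∣⇒≤ {{p^≢0 N}} (subst (_∣ p ^ N) d≡p^v d∣p^N))

  -- Legendre's formula ν(n!) = Σ_{i ≥ 1} ⌊n / p^i⌋, computed with fuel; any fuel ≥ n is enough.
  legendreWithin : ℕ → ℕ → ℕ
  legendreWithin zero    n = 0
  legendreWithin (suc f) n = n / p + legendreWithin f (n / p)

  legendre : ℕ → ℕ
  legendre n = legendreWithin n n

  0/p≡0 : 0 / p ≡ 0
  0/p≡0 = 0/n≡0 p

  legendreWithin-0 : ∀ f → legendreWithin f 0 ≡ 0
  legendreWithin-0 zero    = refl
  legendreWithin-0 (suc f) rewrite 0/p≡0 = legendreWithin-0 f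

  n≤1+f⇒n/p≤f : ∀ n f → n ≤ suc f → n / p ≤ f
  n≤1+f⇒n/p≤f zero    f _   rewrite 0/p≡0 = z≤n
  n≤1+f⇒n/p≤f (suc n) f n≤ = ≤-pred (≤-trans (m/n<m (suc n) p 1<p) n≤)

  legendreWithin-fuel : ∀ f g n → n ≤ f → n ≤ g → legendreWithin f n ≡ legendreWithin g n
  legendreWithin-fuel zero    g       _ z≤n _   = sym (legendreWithin-0 g)
  legendreWithin-fuel (suc f) zero    _ _   z≤n = legendreWithin-0 (suc f)
  legendreWithin-fuel (suc f) (suc g) n n≤f n≤g = cong (n / p +_)
    (legendreWithin-fuel f g (n / p) (n≤1+f⇒n/p≤f n f n≤f) (n≤1+f⇒n/p≤f n g n≤g))

  legendre-unfold : ∀ n → legendre n ≡ n / p + legendre (n / p)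
  legendre-unfold zero rewrite 0/p≡0 = refl
  legendre-unfold (suc n) = cong (suc n / p +_)
    (legendreWithin-fuel n (suc n / p) (suc n / p) (n≤1+f⇒n/p≤f (suc n) n ≤-refl) ≤-refl)

  legendre-digit : ∀ a x → a < p → legendre (a + x * p) ≡ x + legendre x
  legendre-digit a x a<p = trans (legendre-unfold (a + x * p)) (cong (λ z → z + legendre z) ([r+q*d]/d≡q a x a<p))

  legendre-< : ∀ a → a < p → legendre a ≡ 0
  legendre-< a a<p = trans (cong legendre (sym (+-identityʳ a))) (legendre-digit a 0 a<p)

  p∸1<p : p ∸ 1 < p
  p∸1<p = subst (p ∸ 1 <_) (suc-pred p) (n<1+n (p ∸ 1))

  legendre-suc-∤ : ∀ n → p ∤ suc n → legendre (suc n) ≡ legendre n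
  legendre-suc-∤ n p∤ with suc n % p in r≡
  ... | zero  = ⊥-elim (p∤ (m%n≡0⇒n∣m (suc n) p r≡))
  ... | suc a = begin
      legendre (suc n)         ≡⟨ cong legendre n+1≡ ⟩
      legendre (suc a + q * p) ≡⟨ legendre-digit (suc a) q a<p ⟩
      q + legendre q           ≡⟨ sym (legendre-digit a q (<⇒≤ a<p)) ⟩
      legendre (a + q * p)     ≡⟨ cong legendre (suc-injective (sym n+1≡)) ⟩
      legendre n               ∎
    where
    open ≡-Reasoning
    q = suc n / p
    n+1≡ : suc n ≡ suc a + q * p
    n+1≡ = trans (m≡m%n+[m/n]*n (suc n) p) (cong (_+ q * p) r≡)
    a<p : suc a < p
    a<p = subst (_< p) r≡ (m%n<n (suc n) p)

  legendre-suc : ∀ n {e} → Val (suc n) e → legendre (suc n) ≡ e + legendre n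
  legendre-suc = <-rec (λ n → ∀ {e} → Val (suc n) e → legendre (suc n) ≡ e + legendre n) step
    where
    step : ∀ n → (∀ {m} → m < n → ∀ {e} → Val (suc m) e → legendre (suc m) ≡ e + legendre m) →
           ∀ {e} → Val (suc n) e → legendre (suc n) ≡ e + legendre n
    step n rec {e} n+1-val with p ∣? suc n
    ... | no p∤ = trans (legendre-suc-∤ n p∤) (cong (_+ legendre n) (Val-unique (Val-∤ p∤) n+1-val))
    ... | yes (divides (suc q) n+1≡q*p) = begin
        legendre (suc n)             ≡⟨ cong legendre n+1≡q*p ⟩
        legendre (0 + suc q * p)     ≡⟨ legendre-digit 0 (suc q) (<-trans z<s 1<p) ⟩
        suc q + legendre (suc q)     ≡⟨ cong (suc q +_) (rec q<n q-val) ⟩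
        suc q + (e′ + legendre q)    ≡⟨ regroup q e′ (legendre q) ⟩
        (e′ + 1) + (q + legendre q)  ≡⟨ cong₂ _+_ e′+1≡e (sym (legendre-digit (p ∸ 1) q p∸1<p)) ⟩
        e + legendre (p ∸ 1 + q * p) ≡⟨ cong (λ z → e + legendre z) (sym n≡) ⟩
        e + legendre n               ∎
      where
      open ≡-Reasoning
      regroup : ∀ q e L → suc q + (e + L) ≡ (e + 1) + (q + L)
      regroup = solve-∀
      e′ = proj₁ (Val-exists (suc q) λ ())
      q-val = proj₂ (Val-exists (suc q) λ ())
      e′+1≡e : e′ + 1 ≡ e
      e′+1≡e = Val-unique (subst (λ z → Val z (e′ + 1)) (sym n+1≡q*p) (Val-* q-val Val-p)) n+1-val
      n≡ : n ≡ p ∸ 1 + q * p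
      n≡ = suc-injective (trans n+1≡q*p (cong (_+ q * p) (sym (suc-pred p))))
      q<n : q < n
      q<n = subst (q <_) (sym n≡) (+-mono-≤ (m<n⇒0<n∸m 1<p) (m≤m*n q p))

  Val-! : ∀ n → Val (n !) (legendre n)
  Val-! zero    = Val-∤ p∤1
  Val-! (suc n) with Val-exists (suc n) (λ ())
  ... | e , n+1-val = subst (Val (suc n !)) (sym (legendre-suc n n+1-val)) (Val-* n+1-val (Val-! n))

module Carries {p : ℕ} (p-prime : Prime p) where

  open Valuation p-prime

  -- carries D c x y counts the carries produced when the lowest D base-p digits of x and y are
  -- added with initial carry c; carryOut D c x y is the carry leaving digit D − 1.
  carry : ℕ → ℕ → ℕ → ℕ
  carry c x y = (x % p + y % p + c) / p

  carries : ℕ → ℕ → ℕ → ℕ → ℕ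
  carries zero    c x y = 0
  carries (suc D) c x y = carry c x y + carries D (carry c x y) (x / p) (y / p)

  carryOut : ℕ → ℕ → ℕ → ℕ → ℕ
  carryOut zero    c x y = c
  carryOut (suc D) c x y = carryOut D (carry c x y) (x / p) (y / p)

  digits : ∀ x → x ≡ x % p + x / p * p
  digits x = m≡m%n+[m/n]*n x p

  digit-sum/p≤1 : ∀ {a b c} → a < p → b < p → c ≤ 1 → (a + b + c) / p ≤ 1
  digit-sum/p≤1 {a} {b} {c} a<p b<p c≤1 = ≤-pred (m<n*o⇒m/o<n {n = 2} (begin-strict
      a + b + c   ≤⟨ +-monoʳ-≤ (a + b) c≤1 ⟩
      a + b + 1   ≡⟨ trans (+-assoc a b 1) (cong (a +_) (+-comm b 1)) ⟩
      a + suc b   <⟨ +-mono-<-≤ a<p b<p ⟩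
      p + p       ≡⟨ cong (p +_) (sym (+-identityʳ p)) ⟩
      2 * p       ∎))
    where open ≤-Reasoning

  carry≤1 : ∀ c x y → c ≤ 1 → carry c x y ≤ 1
  carry≤1 c x y = digit-sum/p≤1 (m%n<n x p) (m%n<n y p)

  carryOut≤1 : ∀ D c x y → c ≤ 1 → carryOut D c x y ≤ 1
  carryOut≤1 zero    c x y c≤1 = c≤1
  carryOut≤1 (suc D) c x y c≤1 = carryOut≤1 D _ _ _ (carry≤1 c x y c≤1)

  /p<p^ : ∀ D x → x < p ^ suc D → x / p < p ^ D
  /p<p^ D x x< = m<n*o⇒m/o<n (subst (x <_) (*-comm p (p ^ D)) x<)

  legendre-+ : ∀ D c x y → c ≤ 1 → x < p ^ D → y < p ^ D →
               legendre (x + y + c) ≡ legendre x + legendre y + carries D c x y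
  legendre-+ zero    c x y c≤1 (s≤s z≤n) (s≤s z≤n) = legendre-< c (≤-<-trans c≤1 1<p)
  legendre-+ (suc D) c x y c≤1 x< y< = begin
      legendre (x + y + c)
        ≡⟨ cong legendre sum≡ ⟩
      legendre (r + (x′ + y′ + q) * p)
        ≡⟨ legendre-digit r (x′ + y′ + q) (m%n<n (a + b + c) p) ⟩
      (x′ + y′ + q) + legendre (x′ + y′ + q)
        ≡⟨ cong ((x′ + y′ + q) +_) (legendre-+ D q x′ y′ (carry≤1 c x y c≤1) (/p<p^ D x x<) (/p<p^ D y y<)) ⟩
      (x′ + y′ + q) + (legendre x′ + legendre y′ + carries D q x′ y′)
        ≡⟨ regroup x′ y′ q (legendre x′) (legendre y′) (carries D q x′ y′) ⟩
      (x′ + legendre x′) + (y′ + legendre y′) + (q + carries D q x′ y′)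
        ≡⟨ cong₂ (λ u v → u + v + carries (suc D) c x y) (sym (legendre-digit a x′ (m%n<n x p))) (sym (legendre-digit b y′ (m%n<n y p))) ⟩
      legendre (a + x′ * p) + legendre (b + y′ * p) + carries (suc D) c x y
        ≡⟨ cong₂ (λ u v → legendre u + legendre v + carries (suc D) c x y) (sym (digits x)) (sym (digits y)) ⟩
      legendre x + legendre y + carries (suc D) c x y ∎
    where
    open ≡-Reasoning
    a = x % p
    b = y % p
    x′ = x / p
    y′ = y / p
    q = carry c x y
    r = (a + b + c) % p
    regroup : ∀ x′ y′ q u v w → (x′ + y′ + q) + (u + v + w) ≡ (x′ + u) + (y′ + v) + (q + w)
    regroup = solve-∀
    expand : ∀ a b c x′ y′ p → a + x′ * p + (b + y′ * p) + c ≡ a + b + c + (x′ + y′) * p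
    expand = solve-∀
    collect : ∀ r q x′ y′ p → r + q * p + (x′ + y′) * p ≡ r + (x′ + y′ + q) * p
    collect = solve-∀
    sum≡ : x + y + c ≡ r + (x′ + y′ + q) * p
    sum≡ = begin
      x + y + c                             ≡⟨ cong₂ (λ u v → u + v + c) (digits x) (digits y) ⟩
      a + x′ * p + (b + y′ * p) + c         ≡⟨ expand a b c x′ y′ p ⟩
      a + b + c + (x′ + y′) * p             ≡⟨ cong (_+ (x′ + y′) * p) (digits (a + b + c)) ⟩
      r + q * p + (x′ + y′) * p             ≡⟨ collect r q x′ y′ p ⟩
      r + (x′ + y′ + q) * p                 ∎

  binomial*factorials : ∀ {n s} → s ≤ n → (n C s) * (s ! * (n ∸ s) !) ≡ n !
  binomial*factorials {n} {s} s≤n =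
    trans (cong (_* (s ! * (n ∸ s) !)) (nCk≡n!/k![n-k]! s≤n)) (m/n*n≡m (k![n∸k]!∣n! s≤n))
    where instance _ = s !* (n ∸ s) !≢0

  Val-binomial : ∀ D s r → s < p ^ D → r < p ^ D → Val ((s + r) C s) (carries D 0 s r)
  Val-binomial D s r s< r< with Val-exists ((s + r) C s) C≢0
    where
    C≢0 : (s + r) C s ≢ 0
    C≢0 C≡0 = ≢-nonZero⁻¹ ((s + r) !) {{(s + r) !≢0}}
      (trans (sym (binomial*factorials (m≤m+n s r))) (cong (_* (s ! * (s + r ∸ s) !)) C≡0))
  ... | v , C-val = subst (Val ((s + r) C s)) v≡ C-val
    where
    product-val : Val ((s + r) !) (v + (legendre s + legendre r))
    product-val = subst₂ Val (binomial*factorials (m≤m+n s r)) (cong (λ z → v + (legendre s + legendre z)) (m+n∸m≡n s r))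
      (Val-* C-val (Val-* (Val-! s) (Val-! (s + r ∸ s))))
    v≡ : v ≡ carries D 0 s r
    v≡ = +-cancelʳ-≡ (legendre s + legendre r) v (carries D 0 s r) (begin
      v + (legendre s + legendre r)            ≡⟨ Val-unique product-val (Val-! (s + r)) ⟩
      legendre (s + r)                         ≡⟨ cong legendre (sym (+-identityʳ (s + r))) ⟩
      legendre (s + r + 0)                     ≡⟨ legendre-+ D 0 s r z≤n s< r< ⟩
      legendre s + legendre r + carries D 0 s r ≡⟨ +-comm (legendre s + legendre r) _ ⟩
      carries D 0 s r + (legendre s + legendre r) ∎)
      where open ≡-Reasoning

  carries-digits : ∀ D c a b X Y → a < p → b < p →
    carries (suc D) c (a + X * p) (b + Y * p) ≡ (a + b + c) / p + carries D ((a + b + c) / p) X Y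
  carries-digits D c a b X Y a<p b<p
    rewrite [r+q*d]%d≡r a X a<p | [r+q*d]%d≡r b Y b<p | [r+q*d]/d≡q a X a<p | [r+q*d]/d≡q b Y b<p = refl

  carryOut≤carries+c : ∀ t c x y → carryOut t c x y ≤ carries t c x y + c
  carryOut≤carries+c zero    c x y = ≤-refl
  carryOut≤carries+c (suc t) c x y = ≤-trans (carryOut≤carries+c t q (x / p) (y / p))
    (subst (_≤ q + carries t q (x / p) (y / p) + c) (+-comm q _) (m≤m+n _ c))
    where q = carry c x y

  split-digit : ∀ t x S → x + S * p ^ suc t ≡ x % p + (x / p + S * p ^ t) * p
  split-digit t x S = trans (cong (_+ S * p ^ suc t) (digits x)) (regroup p (x % p) (x / p) S (p ^ t))
    where
    regroup : ∀ p a b S P → a + b * p + S * (p * P) ≡ a + (b + S * P) * p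
    regroup = solve-∀

  carries-split : ∀ t D c S R x r → x < p ^ t → r < p ^ t →
    carries (t + D) c (x + S * p ^ t) (r + R * p ^ t) ≡ carries t c x r + carries D (carryOut t c x r) S R
  carries-split zero    D c S R .0 .0 (s≤s z≤n) (s≤s z≤n) rewrite *-identityʳ S | *-identityʳ R = refl
  carries-split (suc t) D c S R x r x< r< = begin
      carries (suc (t + D)) c (x + S * p ^ suc t) (r + R * p ^ suc t)
        ≡⟨ cong₂ (carries (suc (t + D)) c) (split-digit t x S) (split-digit t r R) ⟩
      carries (suc (t + D)) c (x % p + (x / p + S * p ^ t) * p) (r % p + (r / p + R * p ^ t) * p)
        ≡⟨ carries-digits (t + D) c (x % p) (r % p) _ _ (m%n<n x p) (m%n<n r p) ⟩
      q + carries (t + D) q (x / p + S * p ^ t) (r / p + R * p ^ t)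
        ≡⟨ cong (q +_) (carries-split t D q S R (x / p) (r / p) (/p<p^ t x x<) (/p<p^ t r r<)) ⟩
      q + (carries t q (x / p) (r / p) + carries D (carryOut t q (x / p) (r / p)) S R)
        ≡⟨ sym (+-assoc q _ _) ⟩
      carries (suc t) c x r + carries D (carryOut (suc t) c x r) S R ∎
    where
    open ≡-Reasoning
    q = carry c x r

  low-sum : ∀ t c x r → c ≤ 1 → x < p ^ t → r < p ^ t →
    ∃ λ m → m < p ^ t × x + r + c ≡ m + carryOut t c x r * p ^ t
  low-sum zero    c .0 .0 c≤1 (s≤s z≤n) (s≤s z≤n) = 0 , s≤s z≤n , sym (*-identityʳ c)
  low-sum (suc t) c x r c≤1 x< r< with low-sum t q (x / p) (r / p) (carry≤1 c x r c≤1) (/p<p^ t x x<) (/p<p^ t r r<)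
    where q = carry c x r
  ... | m , m< , sum≡ = m₀ + m * p , bound , eq
    where
    q = carry c x r
    m₀ = (x % p + r % p + c) % p
    out = carryOut t q (x / p) (r / p)
    bound : m₀ + m * p < p ^ suc t
    bound = begin-strict
      m₀ + m * p   <⟨ +-monoˡ-< (m * p) (m%n<n _ p) ⟩
      suc m * p    ≤⟨ *-monoˡ-≤ p m< ⟩
      p ^ t * p    ≡⟨ *-comm (p ^ t) p ⟩
      p ^ suc t    ∎
      where open ≤-Reasoning
    expand : ∀ p a b A B c → a + A * p + (b + B * p) + c ≡ (a + b + c) + (A + B) * p
    expand = solve-∀
    collect : ∀ p m₀ q A B → m₀ + q * p + (A + B) * p ≡ m₀ + (A + B + q) * p
    collect = solve-∀
    distribute : ∀ p m₀ m c P → m₀ + (m + c * P) * p ≡ m₀ + m * p + c * (p * P)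
    distribute = solve-∀
    eq : x + r + c ≡ m₀ + m * p + out * p ^ suc t
    eq = begin
      x + r + c                                 ≡⟨ cong₂ (λ u v → u + v + c) (digits x) (digits r) ⟩
      x % p + x / p * p + (r % p + r / p * p) + c ≡⟨ expand p (x % p) (r % p) (x / p) (r / p) c ⟩
      (x % p + r % p + c) + (x / p + r / p) * p ≡⟨ cong (_+ (x / p + r / p) * p) (digits (x % p + r % p + c)) ⟩
      m₀ + q * p + (x / p + r / p) * p          ≡⟨ collect p m₀ q (x / p) (r / p) ⟩
      m₀ + (x / p + r / p + q) * p              ≡⟨ cong (λ z → m₀ + z * p) sum≡ ⟩
      m₀ + (m + out * p ^ t) * p                  ≡⟨ distribute p m₀ m out (p ^ t) ⟩
      m₀ + m * p + out * p ^ suc t                ∎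
      where open ≡-Reasoning

  0%p≡0 : 0 % p ≡ 0
  0%p≡0 = m<n⇒m%n≡m (<-trans z<s 1<p)

  carry-1-0-0 : carry 1 0 0 ≡ 0
  carry-1-0-0 = trans (cong (λ z → (z + z + 1) / p) 0%p≡0) (m<n⇒m/n≡0 1<p)

  carry-0 : ∀ x → carry 0 x 0 ≡ 0
  carry-0 x = trans (cong (λ z → (x % p + z + 0) / p) 0%p≡0)
    (trans (cong (_/ p) (trans (+-identityʳ _) (+-identityʳ _))) (m<n⇒m/n≡0 (m%n<n x p)))

  carries-0 : ∀ D x → carries D 0 x 0 ≡ 0
  carries-0 zero    x = refl
  carries-0 (suc D) x rewrite carry-0 x | 0/p≡0 = carries-0 D (x / p)

  carryOut-0 : ∀ D x → carryOut D 0 x 0 ≡ 0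
  carryOut-0 zero    x = refl
  carryOut-0 (suc D) x rewrite carry-0 x | 0/p≡0 = carryOut-0 D (x / p)

  maxDigits : ℕ → ℕ
  maxDigits zero    = 0
  maxDigits (suc j) = p ∸ 1 + maxDigits j * p

  1+maxDigits : ∀ j → suc (maxDigits j) ≡ p ^ j
  1+maxDigits zero    = refl
  1+maxDigits (suc j) = begin
      suc (p ∸ 1 + maxDigits j * p) ≡⟨ cong (_+ maxDigits j * p) (suc-pred p) ⟩
      suc (maxDigits j) * p         ≡⟨ cong (_* p) (1+maxDigits j) ⟩
      p ^ j * p                     ≡⟨ *-comm (p ^ j) p ⟩
      p ^ suc j                     ∎
    where open ≡-Reasoning

  maxDigits-shift : ∀ j X → maxDigits (suc j) + X * p ^ suc j ≡ p ∸ 1 + (maxDigits j + X * p ^ j) * p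
  maxDigits-shift j X = regroup p (p ∸ 1) (maxDigits j) X (p ^ j)
    where
    regroup : ∀ p a o X P → a + o * p + X * (p * P) ≡ a + (o + X * P) * p
    regroup = solve-∀

  carries-1-p∸1 : ∀ D S y → carries (suc D) 1 (p ∸ 1 + S * p) y ≡ 1 + carries D 1 S (y / p)
  carries-1-p∸1 D S y = begin
      carries (suc D) 1 (p ∸ 1 + S * p) y
        ≡⟨ cong (carries (suc D) 1 (p ∸ 1 + S * p)) (digits y) ⟩
      carries (suc D) 1 (p ∸ 1 + S * p) (y % p + y / p * p)
        ≡⟨ carries-digits D 1 (p ∸ 1) (y % p) S (y / p) p∸1<p (m%n<n y p) ⟩
      q + carries D q S (y / p)
        ≡⟨ cong (λ c → c + carries D c S (y / p)) q≡1 ⟩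
      1 + carries D 1 S (y / p) ∎
    where
    open ≡-Reasoning
    q = (p ∸ 1 + y % p + 1) / p
    shuffle : ∀ a b → a + b + 1 ≡ b + (suc a + 0)
    shuffle = solve-∀
    q≡1 : q ≡ 1
    q≡1 = trans (cong (_/ p) (trans (shuffle (p ∸ 1) (y % p)) (cong (λ z → y % p + (z + 0)) (suc-pred p))))
                ([r+q*d]/d≡q (y % p) 1 (m%n<n y p))

  carries-p∸1+0 : ∀ D S y → carries (suc D) 0 (p ∸ 1 + S * p) (0 + y * p) ≡ carries D 0 S y
  carries-p∸1+0 D S y = trans (carries-digits D 0 (p ∸ 1) 0 S y p∸1<p (<-trans z<s 1<p))
                              (cong (λ q → q + carries D q S y) (m<n⇒m/n≡0 p∸1+0+0<p))
    where
    p∸1+0+0<p : p ∸ 1 + 0 + 0 < p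
    p∸1+0+0<p = subst (_< p) (sym (trans (+-identityʳ _) (+-identityʳ _))) p∸1<p

  Propagates : ℕ → ℕ → ℕ → Set
  Propagates D j S = ∀ y → j ≤ carries D 1 S y

  propagates-p∸1 : ∀ D j S → Propagates D j S → Propagates (suc D) (suc j) (p ∸ 1 + S * p)
  propagates-p∸1 D j S prop y = subst (suc j ≤_) (sym (carries-1-p∸1 D S y)) (s≤s (prop (y / p)))

  propagates-maxDigits : ∀ D j H → j ≤ D → Propagates D j (maxDigits j + H * p ^ j)
  propagates-maxDigits D       zero    H _         y = z≤n
  propagates-maxDigits (suc D) (suc j) H (s≤s j≤D) =
    subst (Propagates (suc D) (suc j)) (sym (maxDigits-shift j H))
      (propagates-p∸1 D j _ (propagates-maxDigits D j H j≤D))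

  carries-1-0-maxDigits : ∀ j D → j ≤ D → carries D 1 0 (maxDigits j) ≡ j
  carries-1-0-maxDigits zero    zero    _ = refl
  carries-1-0-maxDigits zero    (suc D) _ rewrite carry-1-0-0 | 0/p≡0 = carries-0 D 0
  carries-1-0-maxDigits (suc j) (suc D) (s≤s j≤D) = begin
      carries (suc D) 1 0 (maxDigits (suc j))
        ≡⟨ carries-digits D 1 0 (p ∸ 1) 0 (maxDigits j) (<-trans z<s 1<p) p∸1<p ⟩
      (p ∸ 1 + 1) / p + carries D ((p ∸ 1 + 1) / p) 0 (maxDigits j)
        ≡⟨ cong (λ c → c + carries D c 0 (maxDigits j)) [p∸1+1]/p≡1 ⟩
      1 + carries D 1 0 (maxDigits j)
        ≡⟨ cong suc (carries-1-0-maxDigits j D j≤D) ⟩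
      suc j ∎
    where
    open ≡-Reasoning
    [p∸1+1]/p≡1 : (p ∸ 1 + 1) / p ≡ 1
    [p∸1+1]/p≡1 = trans (cong (_/ p) (trans (+-comm (p ∸ 1) 1) (suc-pred p))) (n/n≡1 p)

  carries-digit-maxDigits : ∀ l D b → 1 ≤ b → b < p → l ≤ D → carries D 0 b (maxDigits l) ≡ l
  carries-digit-maxDigits zero    D       b _   _   _         = carries-0 D b
  carries-digit-maxDigits (suc l) (suc D) (suc b) _ b<p (s≤s l≤D) = begin
      carries (suc D) 0 (suc b) (maxDigits (suc l))
        ≡⟨ cong (λ z → carries (suc D) 0 z (maxDigits (suc l))) (sym (+-identityʳ (suc b))) ⟩
      carries (suc D) 0 (suc b + 0 * p) (p ∸ 1 + maxDigits l * p)
        ≡⟨ carries-digits D 0 (suc b) (p ∸ 1) 0 (maxDigits l) b<p p∸1<p ⟩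
      (suc b + (p ∸ 1) + 0) / p + carries D ((suc b + (p ∸ 1) + 0) / p) 0 (maxDigits l)
        ≡⟨ cong (λ c → c + carries D c 0 (maxDigits l)) [b+p]/p≡1 ⟩
      1 + carries D 1 0 (maxDigits l)
        ≡⟨ cong suc (carries-1-0-maxDigits l D l≤D) ⟩
      suc l ∎
    where
    open ≡-Reasoning
    shuffle : ∀ b a → suc b + a + 0 ≡ b + (suc a + 0)
    shuffle = solve-∀
    [b+p]/p≡1 : (suc b + (p ∸ 1) + 0) / p ≡ 1
    [b+p]/p≡1 = trans (cong (_/ p) (trans (shuffle b (p ∸ 1)) (cong (λ z → b + (z + 0)) (suc-pred p))))
                  ([r+q*d]/d≡q b 1 (<-trans (n<1+n b) b<p))

-- Reduction modulo p^ℓ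

module Agreement {p : ℕ} (p-prime : Prime p) where

  open Valuation p-prime

  _≈ν_ : ℕ → ℕ → Set
  x ≈ν y = ((x ≡ 0) ⇔ (y ≡ 0)) × (x ≢ 0 → ∀ i → HasVal p i x ⇔ HasVal p i y)

  ≈ν-respʳ : ∀ {x y z} → x ≈ν y → y ≡ z → x ≈ν z
  ≈ν-respʳ {x} x≈y y≡z = subst (x ≈ν_) y≡z x≈y

  data Agree (ℓ x y : ℕ) : Set where
    both-divisible : p ^ ℓ ∣ x → p ^ ℓ ∣ y → Agree ℓ x y
    same-val       : ∀ {v} → Val x v → Val y v → Agree ℓ x y

  HasVal-same : ∀ {x y v} → Val x v → Val y v → ∀ i → HasVal p i x ⇔ HasVal p i y
  HasVal-same x-val y-val i = mk⇔ (transfer x-val y-val) (transfer y-val x-val)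
    where
    transfer : ∀ {x y v} → Val x v → Val y v → HasVal p i x → HasVal p i y
    transfer {y = y} x-val y-val h = subst (λ j → HasVal p j y) (sym (HasVal⇒≡ {i = i} x-val h)) (Val⇒HasVal y-val)

  module _ (ℓ : ℕ) where

    instance
      _ = p^≢0 ℓ

    mod-zero : ∀ {x} → p ^ ℓ ∣ x → x %′ (p ^ ℓ) ≡ 0
    mod-zero {x} p^ℓ∣x = trans (%′≡% (p ^ ℓ) x) (n∣m⇒m%n≡0 x (p ^ ℓ) p^ℓ∣x)

    mod-nonzero : ∀ {x v} → Val x v → v < ℓ → x %′ (p ^ ℓ) ≢ 0
    mod-nonzero {x} x-val v<ℓ x%≡0 = proj₂ (Val⇒HasVal x-val)
      (∣-trans (p^-∣-p^ v<ℓ) (m%n≡0⇒n∣m x (p ^ ℓ) (trans (sym (%′≡% (p ^ ℓ) x)) x%≡0)))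

    HasVal-mod : ∀ {x} i → i < ℓ → HasVal p i (x %′ (p ^ ℓ)) ⇔ HasVal p i x
    HasVal-mod {x} i i<ℓ = mk⇔
      (λ (d , nd) → ∣n∣m%n⇒∣m (p^-∣-p^ (<⇒≤ i<ℓ)) (subst (p ^ i ∣_) x%≡ d)
                  , λ d′ → nd (subst (p ^ suc i ∣_) (sym x%≡) (%-presˡ-∣ d′ (p^-∣-p^ i<ℓ))))
      (λ (d , nd) → subst (p ^ i ∣_) (sym x%≡) (%-presˡ-∣ d (p^-∣-p^ (<⇒≤ i<ℓ)))
                  , λ d′ → nd (∣n∣m%n⇒∣m (p^-∣-p^ i<ℓ) (subst (p ^ suc i ∣_) x%≡ d′)))
      where x%≡ = %′≡% (p ^ ℓ) x

    ¬HasVal-mod : ∀ {x} i → ℓ ≤ i → x %′ (p ^ ℓ) ≢ 0 → ¬ HasVal p i (x %′ (p ^ ℓ))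
    ¬HasVal-mod {x} i ℓ≤i x%≢0 (p^i∣ , _) = <⇒≱ x%<p^ℓ (≤-trans (^-monoʳ-≤ p ℓ≤i) (∣⇒≤ {{≢-nonZero x%≢0}} p^i∣))
      where
      x%<p^ℓ : x %′ (p ^ ℓ) < p ^ ℓ
      x%<p^ℓ = subst (_< p ^ ℓ) (sym (%′≡% (p ^ ℓ) x)) (m%n<n x (p ^ ℓ))

    Agree⇒≈ν : ∀ {x y} → Agree ℓ x y → (x %′ (p ^ ℓ)) ≈ν (y %′ (p ^ ℓ))
    Agree⇒≈ν (both-divisible p^ℓ∣x p^ℓ∣y) =
      mk⇔ (λ _ → mod-zero p^ℓ∣y) (λ _ → mod-zero p^ℓ∣x) , λ x%≢0 → ⊥-elim (x%≢0 (mod-zero p^ℓ∣x))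
    Agree⇒≈ν (same-val {v} x-val y-val) with ℓ ≤? v
    ... | yes ℓ≤v = Agree⇒≈ν (both-divisible (divisible x-val) (divisible y-val))
      where
      divisible : ∀ {z} → Val z v → p ^ ℓ ∣ z
      divisible z-val = ∣-trans (p^-∣-p^ ℓ≤v) (proj₁ (Val⇒HasVal z-val))
    ... | no ℓ≰v = mk⇔ (λ z → ⊥-elim (mod-nonzero x-val v<ℓ z)) (λ z → ⊥-elim (mod-nonzero y-val v<ℓ z)) , same
      where
      v<ℓ = ≰⇒> ℓ≰v
      same : _ ≢ 0 → ∀ i → HasVal p i _ ⇔ HasVal p i _
      same x%≢0 i with i <? ℓ
      ... | yes i<ℓ = mk⇔
        (λ h → Equivalence.from (HasVal-mod i i<ℓ) (Equivalence.to (HasVal-same x-val y-val i) (Equivalence.to (HasVal-mod i i<ℓ) h)))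
        (λ h → Equivalence.from (HasVal-mod i i<ℓ) (Equivalence.from (HasVal-same x-val y-val i) (Equivalence.to (HasVal-mod i i<ℓ) h)))
      ... | no i≮ℓ = mk⇔ (λ h → ⊥-elim (¬HasVal-mod i (≮⇒≥ i≮ℓ) x%≢0 h))
                         (λ h → ⊥-elim (¬HasVal-mod i (≮⇒≥ i≮ℓ) (mod-nonzero y-val v<ℓ) h))

module BinomialCarries {p : ℕ} (p-prime : Prime p) where

  open Valuation p-prime
  open Carries p-prime

  n<p^n : ∀ n → n < p ^ n
  n<p^n zero    = s≤s z≤n
  n<p^n (suc n) = begin-strict
      suc n     ≤⟨ n<p^n n ⟩
      p ^ n     <⟨ m<m*n (p ^ n) p {{p^≢0 n}} 1<p ⟩
      p ^ n * p ≡⟨ *-comm (p ^ n) p ⟩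
      p ^ suc n ∎
    where open ≤-Reasoning

  ≤⇒<p^ : ∀ {x D} → x ≤ D → x < p ^ D
  ≤⇒<p^ {D = D} x≤D = ≤-<-trans x≤D (n<p^n D)

  Val-binomial′ : ∀ D {s r n} → s + r ≡ n → n ≤ D → Val (n C s) (carries D 0 s r)
  Val-binomial′ D {s} {r} refl n≤D =
    Val-binomial D s r (≤⇒<p^ (≤-trans (m≤m+n s r) n≤D)) (≤⇒<p^ (≤-trans (m≤n+m r s) n≤D))

  binomial≡0⇒∣ : ∀ d {n s} → n < s → d ∣ n C s
  binomial≡0⇒∣ d n<s = subst (d ∣_) (sym (k>n⇒nCk≡0 n<s)) (d ∣0)

  p^∣binomial : ∀ {ℓ n s} D → n ≤ D → (∀ {r} → s + r ≡ n → ℓ ≤ carries D 0 s r) → p ^ ℓ ∣ n C s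
  p^∣binomial {ℓ} {n} {s} D n≤D enough-carries with s ≤? n
  ... | no  s≰n = binomial≡0⇒∣ (p ^ ℓ) (≰⇒> s≰n)
  ... | yes s≤n = ∣-trans (p^-∣-p^ (enough-carries s+r≡n)) (proj₁ (Val⇒HasVal (Val-binomial′ D s+r≡n n≤D)))
    where s+r≡n = m+[n∸m]≡n s≤n

  -- The sum (x + S p^t) + r = R + X p^t cut at digit t: r = rₗ + rₕ p^t, and c is the carry across digit t.
  record SumSplit (t D x S r R X : ℕ) : Set where
    field
      rₗ rₕ c   : ℕ
      rₗ<       : rₗ < p ^ t
      c≡        : c ≡ carryOut t 0 x rₗ
      c≤1       : c ≤ 1
      c≤carries : c ≤ carries t 0 x rₗ
      carries≡  : carries (t + D) 0 (x + S * p ^ t) r ≡ carries t 0 x rₗ + carries D c S rₕ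
      low≡      : x + rₗ ≡ R + c * p ^ t
      high≡     : S + rₕ + c ≡ X

  sumSplit : ∀ t D S X {x r R} → x < p ^ t → R < p ^ t →
             x + S * p ^ t + r ≡ R + X * p ^ t → SumSplit t D x S r R X
  sumSplit t D S X {x} {r} {R} x< R< sum≡ = record
    { rₗ = rₗ ; rₕ = rₕ ; c = c ; rₗ< = rₗ< ; c≡ = refl
    ; c≤1 = carryOut≤1 t 0 x rₗ z≤n
    ; c≤carries = subst (c ≤_) (+-identityʳ _) (carryOut≤carries+c t 0 x rₗ)
    ; carries≡ = trans (cong (carries (t + D) 0 (x + S * p ^ t)) r≡) (carries-split t D 0 S rₕ x rₗ x< rₗ<)
    ; low≡ = trans low≡ (cong (λ z → z + c * p ^ t) (proj₁ digits≡))
    ; high≡ = proj₂ digits≡ }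
    where
    instance _ = p^≢0 t
    rₗ = r % p ^ t
    rₗ< = m%n<n r (p ^ t)
    rₕ = r / p ^ t
    r≡ : r ≡ rₗ + rₕ * p ^ t
    r≡ = m≡m%n+[m/n]*n r (p ^ t)
    c = carryOut t 0 x rₗ
    low = low-sum t 0 x rₗ z≤n x< rₗ<
    m = proj₁ low
    m< = proj₁ (proj₂ low)
    low≡ : x + rₗ ≡ m + c * p ^ t
    low≡ = trans (sym (+-identityʳ (x + rₗ))) (proj₂ (proj₂ low))
    regroup : ∀ P x S rₗ rₕ m c → x + rₗ ≡ m + c * P → x + S * P + (rₗ + rₕ * P) ≡ m + (S + rₕ + c) * P
    regroup P x S rₗ rₕ m c eq = trans (expand P x S rₗ rₕ) (trans (cong (_+ (S + rₕ) * P) eq) (collect P m c S rₕ))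
      where
      expand : ∀ P x S rₗ rₕ → x + S * P + (rₗ + rₕ * P) ≡ x + rₗ + (S + rₕ) * P
      expand = solve-∀
      collect : ∀ P m c S rₕ → m + c * P + (S + rₕ) * P ≡ m + (S + rₕ + c) * P
      collect = solve-∀
    digits≡ : m ≡ R × S + rₕ + c ≡ X
    digits≡ = divMod-unique m R (S + rₕ + c) X m< R<
      (trans (sym (regroup (p ^ t) x S rₗ rₕ m c low≡)) (trans (cong (x + S * p ^ t +_) (sym r≡)) sum≡))

  wrap⇒carry≡1 : ∀ {P x rₗ R c} → c ≤ 1 → x + rₗ ≡ R + c * P → R < x → c ≡ 1
  wrap⇒carry≡1 {c = zero}        _ low≡ R<x = ⊥-elim (<⇒≱ R<x (subst (_ ≤_) (trans low≡ (+-identityʳ _)) (m≤m+n _ _)))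
  wrap⇒carry≡1 {c = suc zero}    _ _    _   = refl
  wrap⇒carry≡1 {c = suc (suc _)} (s≤s ()) _ _

  ¬wrap⇒carry≡0 : ∀ {P x rₗ R c} → x + rₗ ≡ R + c * P → rₗ < P → x ≤ R → c ≡ 0
  ¬wrap⇒carry≡0 {c = zero}  _ _ _ = refl
  ¬wrap⇒carry≡0 {P} {x} {rₗ} {R} {suc c} low≡ rₗ<P x≤R =
    ⊥-elim (<⇒≱ (+-monoʳ-< x rₗ<P) (subst (x + P ≤_) (sym low≡) (+-mono-≤ x≤R (m≤m+n P (c * P)))))

  digit-p∸1-absorbs : ∀ S R J {e} → e < p → p ∸ 1 + S * p + (e + R * p) + 0 ≡ p ∸ 1 + J * p → e ≡ 0 × S + R ≡ J
  digit-p∸1-absorbs S R J {e} e<p sum≡ = divMod-unique e 0 (S + R) J e<p (<-trans z<s 1<p)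
    (+-cancelˡ-≡ (p ∸ 1) (e + (S + R) * p) (J * p) (trans (sym (regroup p (p ∸ 1) S e R)) sum≡))
    where
    regroup : ∀ p a S e R → a + S * p + (e + R * p) + 0 ≡ a + (e + (S + R) * p)
    regroup = solve-∀

  high-≤ : ∀ {P x R S J} → R < P → x + S * P ≤ R + J * P → S ≤ J
  high-≤ {P} {x} {R} {S} {J} R<P sum≤ = ≮⇒≥ λ J<S → <⇒≱ (begin-strict
      R + J * P   <⟨ +-monoˡ-< (J * P) R<P ⟩
      suc J * P   ≤⟨ *-monoˡ-≤ P J<S ⟩
      S * P       ≤⟨ m≤n+m (S * P) x ⟩
      x + S * P   ∎) sum≤
    where open ≤-Reasoning

  module _ (t : ℕ) {Lo : ℕ} (Lo< : Lo < p ^ t) where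

    wrap⇒carries : ∀ D j S X {r R} → Propagates D j S → R < p ^ t → R < Lo →
      Lo + S * p ^ t + r ≡ R + X * p ^ t → suc j ≤ carries (t + D) 0 (Lo + S * p ^ t) r
    wrap⇒carries D j S X prop R< R<Lo sum≡ = subst (suc j ≤_) (sym carries≡) (+-mono-≤ low-carry high-carries)
      where
      open SumSplit (sumSplit t D S X Lo< R< sum≡)
      c≡1 : c ≡ 1
      c≡1 = wrap⇒carry≡1 c≤1 low≡ R<Lo
      low-carry : 1 ≤ carries t 0 Lo rₗ
      low-carry = subst (_≤ carries t 0 Lo rₗ) c≡1 c≤carries
      high-carries : j ≤ carries D c S rₕ
      high-carries = subst (λ c → j ≤ carries D c S rₕ) (sym c≡1) (prop rₕ)

    -- Digit t of s is p − 1 and that of the sum is smaller, so a carry must leave digit t.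
    digit<p∸1⇒carries : ∀ D l S′ J {r R a} → Propagates D l S′ → R < p ^ t → a < p ∸ 1 →
      Lo + (p ∸ 1 + S′ * p) * p ^ t + r ≡ R + (a + J * p) * p ^ t →
      suc l ≤ carries (t + suc D) 0 (Lo + (p ∸ 1 + S′ * p) * p ^ t) r
    digit<p∸1⇒carries D l S′ J {r} {R} {a} prop R< a< sum≡ =
      subst (suc l ≤_) (sym carries≡) (≤-trans (subst (λ q → suc l ≤ q + carries D q S′ rₕ′) (sym q≡1) (s≤s (prop rₕ′))) high≤)
      where
      open SumSplit (sumSplit t (suc D) (p ∸ 1 + S′ * p) (a + J * p) Lo< R< sum≡)
      e = rₕ % p
      rₕ′ = rₕ / p
      q = (p ∸ 1 + e + c) / p
      regroup : ∀ p a S′ e R c → a + S′ * p + (e + R * p) + c ≡ (a + e + c) + (S′ + R) * p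
      regroup = solve-∀
      digit≡ : (p ∸ 1 + e + c) + (S′ + rₕ′) * p ≡ a + J * p
      digit≡ = trans (sym (regroup p (p ∸ 1) S′ e rₕ′ c)) (trans (cong (λ z → p ∸ 1 + S′ * p + z + c) (sym (digits rₕ))) high≡)
      q≢0 : q ≢ 0
      q≢0 q≡0 = <⇒≱ a< (subst (p ∸ 1 ≤_) (proj₁ (divMod-unique (p ∸ 1 + e + c) a (S′ + rₕ′) J (m/n≡0⇒m<n q≡0) (<-trans a< p∸1<p) digit≡))
                                   (≤-trans (m≤m+n (p ∸ 1) e) (m≤m+n _ c)))
      q≡1 : q ≡ 1
      q≡1 = ≤-antisym (digit-sum/p≤1 p∸1<p (m%n<n rₕ p) c≤1) (n≢0⇒n>0 q≢0)
      high≤ : q + carries D q S′ rₕ′ ≤ carries t 0 Lo rₗ + carries (suc D) c (p ∸ 1 + S′ * p) rₕ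
      high≤ = subst (q + carries D q S′ rₕ′ ≤_)
        (sym (cong (carries t 0 Lo rₗ +_) (trans (cong (carries (suc D) c (p ∸ 1 + S′ * p)) (digits rₕ))
                                                 (carries-digits D c (p ∸ 1) e S′ rₕ′ p∸1<p (m%n<n rₕ p)))))
        (m≤n+m (q + carries D q S′ rₕ′) (carries t 0 Lo rₗ))

    -- With no carry out of the low digits, digit t of r is 0 and the digit p − 1 of s at t can be deleted.
    drop-digit : ∀ D S′ J {r R} → R < p ^ t → Lo ≤ R →
      Lo + (p ∸ 1 + S′ * p) * p ^ t + r ≡ R + (p ∸ 1 + J * p) * p ^ t →
      ∃ λ r′ → Lo + S′ * p ^ t + r′ ≡ R + J * p ^ t
             × carries (t + suc D) 0 (Lo + (p ∸ 1 + S′ * p) * p ^ t) r ≡ carries (t + D) 0 (Lo + S′ * p ^ t) r′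
    drop-digit D S′ J {r} {R} R< Lo≤R sum≡ = rₗ + rₕ′ * p ^ t , sum′≡ , carries′≡
      where
      open SumSplit (sumSplit t (suc D) (p ∸ 1 + S′ * p) (p ∸ 1 + J * p) Lo< R< sum≡)
      c≡0 : c ≡ 0
      c≡0 = ¬wrap⇒carry≡0 low≡ rₗ< Lo≤R
      rₕ′ = rₕ / p
      absorbed = digit-p∸1-absorbs S′ rₕ′ J (m%n<n rₕ p)
        (trans (cong₂ (λ z c → p ∸ 1 + S′ * p + z + c) (sym (digits rₕ)) (sym c≡0)) high≡)
      rₕ≡ : rₕ ≡ 0 + rₕ′ * p
      rₕ≡ = trans (digits rₕ) (cong (_+ rₕ′ * p) (proj₁ absorbed))
      regroup : ∀ P Lo S′ rₗ R → Lo + S′ * P + (rₗ + R * P) ≡ Lo + rₗ + (S′ + R) * P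
      regroup = solve-∀
      sum′≡ : Lo + S′ * p ^ t + (rₗ + rₕ′ * p ^ t) ≡ R + J * p ^ t
      sum′≡ = trans (regroup (p ^ t) Lo S′ rₗ rₕ′)
        (cong₂ (λ u v → u + v * p ^ t) (trans low≡ (trans (cong (λ c → R + c * p ^ t) c≡0) (+-identityʳ R))) (proj₂ absorbed))
      carries′≡ : carries (t + suc D) 0 (Lo + (p ∸ 1 + S′ * p) * p ^ t) r ≡ carries (t + D) 0 (Lo + S′ * p ^ t) (rₗ + rₕ′ * p ^ t)
      carries′≡ = begin
        carries (t + suc D) 0 (Lo + (p ∸ 1 + S′ * p) * p ^ t) r
          ≡⟨ carries≡ ⟩
        carries t 0 Lo rₗ + carries (suc D) c (p ∸ 1 + S′ * p) rₕ
          ≡⟨ cong₂ (λ c z → carries t 0 Lo rₗ + carries (suc D) c (p ∸ 1 + S′ * p) z) c≡0 rₕ≡ ⟩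
        carries t 0 Lo rₗ + carries (suc D) 0 (p ∸ 1 + S′ * p) (0 + rₕ′ * p)
          ≡⟨ cong (carries t 0 Lo rₗ +_) (carries-p∸1+0 D S′ rₕ′) ⟩
        carries t 0 Lo rₗ + carries D 0 S′ rₕ′
          ≡⟨ cong (λ c → carries t 0 Lo rₗ + carries D c S′ rₕ′) (sym (trans (sym c≡) c≡0)) ⟩
        carries t 0 Lo rₗ + carries D (carryOut t 0 Lo rₗ) S′ rₕ′
          ≡⟨ sym (carries-split t D 0 S′ rₕ′ Lo rₗ Lo< rₗ<) ⟩
        carries (t + D) 0 (Lo + S′ * p ^ t) (rₗ + rₕ′ * p ^ t) ∎
        where open ≡-Reasoning

    ≤-insert-digit : ∀ S′ J {R} → R < p ^ t → Lo ≤ R → Lo + S′ * p ^ t ≤ R + J * p ^ t →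
                     Lo + (p ∸ 1 + S′ * p) * p ^ t ≤ R + (p ∸ 1 + J * p) * p ^ t
    ≤-insert-digit S′ J R< Lo≤R s′≤n′ =
      +-mono-≤ Lo≤R (*-monoˡ-≤ (p ^ t) (+-monoʳ-≤ (p ∸ 1) (*-monoˡ-≤ p (high-≤ {S = S′} {J} R< s′≤n′))))

  -- s and s′ share the low digits Lo and the high part H; s has l + 1 digits p − 1 at positions t, …, t + l,
  -- s′ has l of them at positions t, …, t + l − 1.
  module Spliced (t : ℕ) {Lo : ℕ} (Lo< : Lo < p ^ t) (l H : ℕ) where

    open Agreement p-prime using (Agree; both-divisible; same-val)

    S′ s′ s : ℕ
    S′ = maxDigits l + H * p ^ l
    s′ = Lo + S′ * p ^ t
    s  = Lo + (p ∸ 1 + S′ * p) * p ^ t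


    n≤t+[1+n+l] : ∀ n → n ≤ t + suc (n + l)
    n≤t+[1+n+l] n = m≤n⇒m≤o+n t (≤-trans (m≤m+n n l) (n≤1+n _))

    s-expanded : s ≡ Lo + (p ∸ 1) * p ^ t + S′ * p ^ suc t
    s-expanded = regroup Lo (p ∸ 1) S′ p (p ^ t)
      where
      regroup : ∀ Lo a S p P → Lo + (a + S * p) * P ≡ Lo + a * P + S * (p * P)
      regroup = solve-∀

    s<[1+S′]p^[1+t] : s < suc S′ * p ^ suc t
    s<[1+S′]p^[1+t] = begin-strict
      s                                          ≡⟨ s-expanded ⟩
      Lo + (p ∸ 1) * p ^ t + S′ * p ^ suc t     <⟨ +-monoˡ-< (S′ * p ^ suc t) (+-monoˡ-< ((p ∸ 1) * p ^ t) Lo<) ⟩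
      suc (p ∸ 1) * p ^ t + S′ * p ^ suc t      ≡⟨ cong (λ z → z * p ^ t + S′ * p ^ suc t) (suc-pred p) ⟩
      suc S′ * p ^ suc t                         ∎
      where open ≤-Reasoning

    S′p^[1+t]≤s : S′ * p ^ suc t ≤ s
    S′p^[1+t]≤s = subst (S′ * p ^ suc t ≤_) (sym s-expanded) (m≤n+m _ _)

    p^[a+b]≡p^b*p^a : ∀ a b → p ^ (a + b) ≡ p ^ b * p ^ a
    p^[a+b]≡p^b*p^a a b = trans (^-distribˡ-+-* p a b) (*-comm (p ^ a) (p ^ b))

    s′-bounds : ∀ e → p ^ (suc t + e) ≤ s → s < p ^ (suc t + suc e) → p ^ (t + e) ≤ s′ × s′ < p ^ suc (t + e)
    s′-bounds e p^≤s s<p^ = lower , upper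
      where
      open ≤-Reasoning
      p^e≤S′ : p ^ e ≤ S′
      p^e≤S′ = ≤-pred (*-cancelʳ-< (p ^ suc t) (p ^ e) (suc S′)
                 (≤-<-trans (subst (_≤ s) (p^[a+b]≡p^b*p^a (suc t) e) p^≤s) s<[1+S′]p^[1+t]))
      S′<p^[1+e] : S′ < p ^ suc e
      S′<p^[1+e] = *-cancelʳ-< (p ^ suc t) S′ (p ^ suc e)
                 (≤-<-trans S′p^[1+t]≤s (subst (s <_) (p^[a+b]≡p^b*p^a (suc t) (suc e)) s<p^))
      lower : p ^ (t + e) ≤ s′
      lower = begin
        p ^ (t + e)    ≡⟨ p^[a+b]≡p^b*p^a t e ⟩
        p ^ e * p ^ t  ≤⟨ *-monoˡ-≤ (p ^ t) p^e≤S′ ⟩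
        S′ * p ^ t     ≤⟨ m≤n+m (S′ * p ^ t) Lo ⟩
        s′             ∎
      upper : s′ < p ^ suc (t + e)
      upper = begin-strict
        s′                 <⟨ +-monoˡ-< (S′ * p ^ t) Lo< ⟩
        suc S′ * p ^ t     ≤⟨ *-monoˡ-≤ (p ^ t) S′<p^[1+e] ⟩
        p ^ suc e * p ^ t  ≡⟨ sym (p^[a+b]≡p^b*p^a t (suc e)) ⟩
        p ^ (t + suc e)    ≡⟨ cong (p ^_) (+-suc t e) ⟩
        p ^ suc (t + e)    ∎

    p^∣C-digit<p∸1 : ∀ {R a} J → R < p ^ t → a < p ∸ 1 → p ^ suc l ∣ (R + (a + J * p) * p ^ t) C s
    p^∣C-digit<p∸1 {R} {a} J R< a< = p^∣binomial (t + suc D) (n≤t+[1+n+l] n)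
      (digit<p∸1⇒carries t Lo< D l S′ J (propagates-maxDigits D l H (m≤n+m l n)) R< a<)
      where
      n = R + (a + J * p) * p ^ t
      D = n + l

    agree-digit-p∸1 : ∀ {R} J → R < p ^ t →
      Agree (suc l) ((R + (p ∸ 1 + J * p) * p ^ t) C s) ((R + J * p ^ t) C s′)
    agree-digit-p∸1 {R} J R< with R <? Lo
    ... | yes R<Lo = both-divisible
      (p^∣binomial (t + suc D) (n≤t+[1+n+l] n)
        λ sum≡ → ≤-trans (n≤1+n _) (wrap⇒carries t Lo< (suc D) (suc l) _ (p ∸ 1 + J * p)
                   (propagates-p∸1 D l S′ (propagates-maxDigits D l H (m≤n+m l n))) R< R<Lo sum≡))
      (p^∣binomial (t + D′) (m≤n⇒m≤o+n t (m≤m+n n′ l))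
        (wrap⇒carries t Lo< D′ l S′ J (propagates-maxDigits D′ l H (m≤n+m l n′)) R< R<Lo))
      where
      n = R + (p ∸ 1 + J * p) * p ^ t
      D = n + l
      n′ = R + J * p ^ t
      D′ = n′ + l
    ... | no R≮Lo with s ≤? R + (p ∸ 1 + J * p) * p ^ t
    ... | yes s≤n = same-val (Val-binomial′ (t + suc D) (m+[n∸m]≡n s≤n) (n≤t+[1+n+l] n))
                             (subst (Val _) (sym carries≡) (Val-binomial′ (t + D) sum′≡ (m≤n⇒m≤o+n t (≤-trans n′≤n (m≤m+n n l)))))
      where
      n = R + (p ∸ 1 + J * p) * p ^ t
      D = n + l
      n′ = R + J * p ^ t
      n′≤n : n′ ≤ n
      n′≤n = +-monoʳ-≤ R (*-monoˡ-≤ (p ^ t) (≤-trans (m≤m*n J p) (m≤n+m (J * p) (p ∸ 1))))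
      dropped = drop-digit t Lo< D S′ J R< (≮⇒≥ R≮Lo) (m+[n∸m]≡n s≤n)
      sum′≡ = proj₁ (proj₂ dropped)
      carries≡ = proj₂ (proj₂ dropped)
    ... | no s≰n = both-divisible (binomial≡0⇒∣ _ (≰⇒> s≰n)) (binomial≡0⇒∣ _ (≰⇒> s′≰n′))
      where
      s′≰n′ : s′ ≰ R + J * p ^ t
      s′≰n′ s′≤n′ = s≰n (≤-insert-digit t Lo< S′ J R< (≮⇒≥ R≮Lo) s′≤n′)

module BlockOperator {p : ℕ} .{{_ : NonZero p}} (t : ℕ) (f : ℕ → ℕ) where

  instance
    _ = m^n≢0 p t
    _ = m^n≢0 p (suc t)

  zeros : ℕ
  zeros = (p ∸ 1) * p ^ t

  p^[1+t]≡zeros+p^t : p ^ suc t ≡ zeros + p ^ t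
  p^[1+t]≡zeros+p^t = trans (cong (_* p ^ t) (sym (suc-pred p))) (+-comm (p ^ t) zeros)

  A-block : ∀ Q r → r < p ^ suc t →
    A p t f (Q * p ^ suc t + r) ≡ (if r <ᵇ zeros then 0 else f (Q * p ^ t + (r ∸ zeros)))
  A-block Q r r< = cong₂ (λ u v → if u <ᵇ zeros then 0 else f (v * p ^ t + (u ∸ zeros)))
    (trans (%′≡% (p ^ suc t) _) (trans (cong (_% p ^ suc t) (+-comm (Q * p ^ suc t) r)) ([r+q*d]%d≡r r Q r<)))
    (trans (/′≡/ (p ^ suc t) _) (trans (cong (_/ p ^ suc t) (+-comm (Q * p ^ suc t) r)) ([r+q*d]/d≡q r Q r<)))

  A-zeros : ∀ Q r → r < zeros → A p t f (Q * p ^ suc t + r) ≡ 0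
  A-zeros Q r r<zeros rewrite A-block Q r (<-≤-trans r<zeros (subst (zeros ≤_) (sym p^[1+t]≡zeros+p^t) (m≤m+n zeros (p ^ t))))
    with r <ᵇ zeros | <ᵇ-reflects-< r zeros
  ... | true  | _          = refl
  ... | false | ofⁿ r≮zeros = ⊥-elim (r≮zeros r<zeros)

  A-copy : ∀ Q x → x < p ^ t → A p t f (Q * p ^ suc t + (zeros + x)) ≡ f (Q * p ^ t + x)
  A-copy Q x x< rewrite A-block Q (zeros + x) (subst (zeros + x <_) (sym p^[1+t]≡zeros+p^t) (+-monoʳ-< zeros x<))
    with zeros + x <ᵇ zeros | <ᵇ-reflects-< (zeros + x) zeros
  ... | true  | ofʸ lt = ⊥-elim (<⇒≱ lt (m≤m+n zeros x))
  ... | false | _      = cong (λ u → f (Q * p ^ t + u)) (m+n∸m≡n zeros x)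

  A-view : ∀ n →
      (∃ λ R → ∃ λ a → ∃ λ Q → R < p ^ t × a < p ∸ 1 × n ≡ R + (a + Q * p) * p ^ t × A p t f n ≡ 0)
    ⊎ (∃ λ R → ∃ λ Q → R < p ^ t × n ≡ R + (p ∸ 1 + Q * p) * p ^ t × A p t f n ≡ f (R + Q * p ^ t))
  A-view n with n % p ^ suc t <? zeros
  ... | yes r<zeros = inj₁ (R , a , Q , m%n<n r (p ^ t) , a< , n≡ , trans (cong (A p t f) n≡QB+r) (A-zeros Q r r<zeros))
    where
    Q = n / p ^ suc t
    r = n % p ^ suc t
    R = r % p ^ t
    a = r / p ^ t
    n≡QB+r : n ≡ Q * p ^ suc t + r
    n≡QB+r = trans (m≡m%n+[m/n]*n n (p ^ suc t)) (+-comm r _)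
    r≡ : r ≡ R + a * p ^ t
    r≡ = m≡m%n+[m/n]*n r (p ^ t)
    a< : a < p ∸ 1
    a< = *-cancelʳ-< (p ^ t) a (p ∸ 1) (≤-<-trans (subst (a * p ^ t ≤_) (sym r≡) (m≤n+m (a * p ^ t) R)) r<zeros)
    regroup : ∀ P p R a Q → Q * (p * P) + (R + a * P) ≡ R + (a + Q * p) * P
    regroup = solve-∀
    n≡ : n ≡ R + (a + Q * p) * p ^ t
    n≡ = trans n≡QB+r (trans (cong (Q * p ^ suc t +_) r≡) (regroup (p ^ t) p R a Q))
  ... | no r≮zeros = inj₂ (x , Q , x< , n≡ , trans (cong (A p t f) n≡QB+r) (trans (A-copy Q x x<) (cong f (+-comm _ x))))
    where
    Q = n / p ^ suc t
    r = n % p ^ suc t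
    x = r ∸ zeros
    r≡ : r ≡ zeros + x
    r≡ = sym (m+[n∸m]≡n (≮⇒≥ r≮zeros))
    x< : x < p ^ t
    x< = +-cancelˡ-< zeros x (p ^ t) (subst₂ _<_ r≡ p^[1+t]≡zeros+p^t (m%n<n n (p ^ suc t)))
    n≡QB+r : n ≡ Q * p ^ suc t + (zeros + x)
    n≡QB+r = trans (m≡m%n+[m/n]*n n (p ^ suc t)) (trans (+-comm r _) (cong (Q * p ^ suc t +_) r≡))
    regroup : ∀ P p x a Q → Q * (p * P) + (a * P + x) ≡ x + (a + Q * p) * P
    regroup = solve-∀
    n≡ : n ≡ x + (p ∸ 1 + Q * p) * p ^ t
    n≡ = trans n≡QB+r (regroup (p ^ t) p x (p ∸ 1) Q)

-- Periods

period-* : ∀ {f τ} → IsPeriod f τ → ∀ k n → f (n + k * τ) ≡ f n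
period-* {f} per zero    n = cong f (+-identityʳ n)
period-* {f} {τ} per (suc k) n = trans (cong f (regroup n τ (k * τ))) (trans (proj₂ per (n + k * τ)) (period-* per k n))
  where
  regroup : ∀ n t u → n + (t + u) ≡ n + u + t
  regroup = solve-∀

period-∣ : ∀ {f τ P} → IsPeriod f τ → τ ∣ P → 0 < P → IsPeriod f P
period-∣ per (divides k refl) 0<P = 0<P , period-* per k

minimal-period-∣ : ∀ {f τ P} → IsMinPeriod f τ → IsPeriod f P → τ ∣ P
minimal-period-∣ {f} {τ} {P} (per , minimal) perP = m%n≡0⇒n∣m P τ (remainder≡0 (P % τ) refl)
  where
  instance _ = >-nonZero (proj₁ per)
  remainder≡0 : ∀ r → P % τ ≡ r → P % τ ≡ 0
  remainder≡0 zero    r≡ = r≡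
  remainder≡0 (suc r) r≡ = ⊥-elim (<⇒≱ (subst (_< τ) r≡ (m%n<n P τ)) (minimal (suc r) (z<s , per-r)))
    where
    P≡ : P ≡ suc r + P / τ * τ
    P≡ = trans (m≡m%n+[m/n]*n P τ) (cong (_+ P / τ * τ) r≡)
    per-r : ∀ n → f (n + suc r) ≡ f n
    per-r n = trans (sym (period-* per (P / τ) (n + suc r)))
                (trans (cong f (trans (+-assoc n (suc r) _) (cong (n +_) (sym P≡)))) (proj₂ perP n))

module BinomialPeriod {p : ℕ} (p-prime : Prime p) where

  open Valuation p-prime
  open Carries p-prime
  open BinomialCarries p-prime
  open Agreement p-prime using (mod-zero; mod-nonzero)

  -- Adding j and p^(t+l) − j, a carry leaves the low t digits and then runs through the l top digits p − 1.
  p^∣C[p^,j] : ∀ t l j → 0 < j → j < p ^ t → p ^ suc l ∣ p ^ (t + l) C j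
  p^∣C[p^,j] t l j 0<j j< = p^∣binomial (t + N) (m≤n⇒m≤o+n t ≤-refl) enough-carries
    where
    N = p ^ (t + l)
    enough-carries : ∀ {r} → j + r ≡ N → suc l ≤ carries (t + N) 0 j r
    enough-carries {r} sum≡ = subst (suc l ≤_) (sym carries≡′) (+-mono-≤ low high)
      where
      sum≡′ : j + 0 * p ^ t + r ≡ 0 + p ^ l * p ^ t
      sum≡′ = trans (cong (_+ r) (+-identityʳ j)) (trans sum≡ (trans (^-distribˡ-+-* p t l) (*-comm (p ^ t) (p ^ l))))
      open SumSplit (sumSplit t N 0 (p ^ l) j< (m^n>0 p t) sum≡′)
      carries≡′ : carries (t + N) 0 j r ≡ carries t 0 j rₗ + carries N c 0 rₕ
      carries≡′ = trans (cong (λ x → carries (t + N) 0 x r) (sym (+-identityʳ j))) carries≡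
      c≡1 : c ≡ 1
      c≡1 = wrap⇒carry≡1 c≤1 low≡ 0<j
      rₕ≡ : rₕ ≡ maxDigits l
      rₕ≡ = suc-injective (trans (+-comm 1 rₕ) (trans (cong (rₕ +_) (sym c≡1)) (trans high≡ (sym (1+maxDigits l)))))
      low : 1 ≤ carries t 0 j rₗ
      low = subst (_≤ carries t 0 j rₗ) c≡1 c≤carries
      high : l ≤ carries N c 0 rₕ
      high = ≤-reflexive (sym (trans (cong₂ (λ c y → carries N c 0 y) c≡1 rₕ≡)
                                      (carries-1-0-maxDigits l N (≤-trans (<⇒≤ (n<p^n l)) (^-monoʳ-≤ p (m≤n+m l t))))))

  module _ (K l : ℕ) where

    instance _ = p^≢0 (suc l)

    P : ℕ
    P = p ^ (suc K + l)

    C-periodic : ∀ n s → s < p ^ suc K → ((n + P) C s) % p ^ suc l ≡ (n C s) % p ^ suc l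
    C-periodic zero    zero    _  = refl
    C-periodic zero    (suc s) s< = trans (n∣m⇒m%n≡0 _ _ (p^∣C[p^,j] (suc K) l (suc s) z<s s<))
                                          (sym (trans (cong (_% p ^ suc l) (k>n⇒nCk≡0 {0} {suc s} z<s)) (m<n⇒m%n≡m (m^n>0 p (suc l)))))
    C-periodic (suc n) zero    _  = refl
    C-periodic (suc n) (suc s) s< = begin
        (suc (n + P) C suc s) % M
          ≡⟨ cong (_% M) (sym (nCk+nC[k+1]≡[n+1]C[k+1] (n + P) s)) ⟩
        ((n + P) C s + (n + P) C suc s) % M
          ≡⟨ %-distribˡ-+ ((n + P) C s) _ M ⟩
        (((n + P) C s) % M + ((n + P) C suc s) % M) % M
          ≡⟨ cong₂ (λ u v → (u + v) % M) (C-periodic n s (<-trans (n<1+n s) s<)) (C-periodic n (suc s) s<) ⟩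
        ((n C s) % M + (n C suc s) % M) % M
          ≡⟨ sym (%-distribˡ-+ (n C s) _ M) ⟩
        (n C s + n C suc s) % M
          ≡⟨ cong (_% M) (nCk+nC[k+1]≡[n+1]C[k+1] n s) ⟩
        (suc n C suc s) % M ∎
      where
      open ≡-Reasoning
      M = p ^ suc l

    bin-period : ∀ s → s < p ^ suc K → IsPeriod (bin p (suc l) s) P
    bin-period s s< = m^n>0 p (suc K + l) , λ n →
      trans (%′≡% (p ^ suc l) _) (trans (C-periodic n s s<) (sym (%′≡% (p ^ suc l) _)))

    Val-C-top : ∀ s → p ^ K ≤ s → s < p ^ suc K → Val ((s + maxDigits l * p ^ K) C s) l
    Val-C-top s p^K≤s s< = subst (Val _) carries≡l (Val-binomial′ (K + D) refl (≤-trans (m≤m+n n l) (m≤n+m D K)))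
      where
      instance _ = p^≢0 K
      n = s + maxDigits l * p ^ K
      D = n + l
      Lo = s % p ^ K
      b = s / p ^ K
      s≡ : s ≡ Lo + b * p ^ K
      s≡ = m≡m%n+[m/n]*n s (p ^ K)
      1≤b : 1 ≤ b
      1≤b = m≥n⇒m/n>0 p^K≤s
      b<p : b < p
      b<p = m<n*o⇒m/o<n s<
      carries≡l : carries (K + D) 0 s (maxDigits l * p ^ K) ≡ l
      carries≡l = begin
        carries (K + D) 0 s (0 + maxDigits l * p ^ K)
          ≡⟨ cong (λ z → carries (K + D) 0 z (maxDigits l * p ^ K)) s≡ ⟩
        carries (K + D) 0 (Lo + b * p ^ K) (0 + maxDigits l * p ^ K)
          ≡⟨ carries-split K D 0 b (maxDigits l) Lo 0 (m%n<n s (p ^ K)) (m^n>0 p K) ⟩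
        carries K 0 Lo 0 + carries D (carryOut K 0 Lo 0) b (maxDigits l)
          ≡⟨ cong₂ (λ u c → u + carries D c b (maxDigits l)) (carries-0 K Lo) (carryOut-0 K Lo) ⟩
        carries D 0 b (maxDigits l)
          ≡⟨ carries-digit-maxDigits l D b 1≤b b<p (m≤n+m l n) ⟩
        l ∎
        where open ≡-Reasoning

    -- Shifting s − p^K, where C(·, s) vanishes, by p^(K+l) gives s + (p^l − 1) p^K, where its valuation is l.
    bin-not-period : ∀ s → p ^ K ≤ s → s < p ^ suc K → ¬ IsPeriod (bin p (suc l) s) (p ^ (K + l))
    bin-not-period s p^K≤s s< (_ , per) = mod-nonzero (suc l) (Val-C-top s p^K≤s s<) (n<1+n l) (begin
        bin p (suc l) s (s + maxDigits l * p ^ K)  ≡⟨ cong (bin p (suc l) s) (sym shifted) ⟩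
        bin p (suc l) s (y + p ^ (K + l))          ≡⟨ per y ⟩
        bin p (suc l) s y                          ≡⟨ cong (_%′ (p ^ suc l)) (k>n⇒nCk≡0 y<s) ⟩
        0 %′ (p ^ suc l)                           ≡⟨ mod-zero (suc l) ((p ^ suc l) ∣0) ⟩
        0                                          ∎)
      where
      open ≡-Reasoning
      y = s ∸ p ^ K
      y<s : y < s
      y<s = ∸-monoʳ-< (m^n>0 p K) p^K≤s
      shifted : y + p ^ (K + l) ≡ s + maxDigits l * p ^ K
      shifted = begin
        y + p ^ (K + l)                        ≡⟨ cong (y +_) (trans (^-distribˡ-+-* p K l) (*-comm (p ^ K) (p ^ l))) ⟩
        y + p ^ l * p ^ K                      ≡⟨ cong (λ z → y + z * p ^ K) (sym (1+maxDigits l)) ⟩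
        y + (p ^ K + maxDigits l * p ^ K)      ≡⟨ sym (+-assoc y (p ^ K) _) ⟩
        y + p ^ K + maxDigits l * p ^ K        ≡⟨ cong (_+ maxDigits l * p ^ K) (m∸n+n≡m p^K≤s) ⟩
        s + maxDigits l * p ^ K                ∎

    bin-minimal-period : ∀ s τ → p ^ K ≤ s → s < p ^ suc K → IsMinPeriod (bin p (suc l) s) τ → τ ≡ P
    bin-minimal-period s τ p^K≤s s< mp with ∣p^⇒≡p^ (suc K + l) (minimal-period-∣ mp (bin-period s s<))
    ... | v , v≤ , τ≡p^v with v ≟ suc K + l
    ... | yes v≡ = trans τ≡p^v (cong (p ^_) v≡)
    ... | no  v≢ = ⊥-elim (bin-not-period s p^K≤s s<
                     (period-∣ (proj₁ mp) (subst (_∣ p ^ (K + l)) (sym τ≡p^v) (p^-∣-p^ (≤-pred (≤∧≢⇒< v≤ v≢)))) (m^n>0 p (K + l))))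

-- Counting

module _ {P Q : ℕ → Set} (P? : ∀ x → Dec (P x)) (Q? : ∀ x → Dec (Q x)) where

  count-cong : ∀ n → (∀ x → x < n → P x ⇔ Q x) → count n P P? ≡ count n Q Q?
  count-cong zero    _   = refl
  count-cong (suc n) P⇔Q with P? n | Q? n
  ... | yes _  | yes _  = cong suc (count-cong n λ x x<n → P⇔Q x (<-trans x<n (n<1+n n)))
  ... | no  _  | no  _  = count-cong n λ x x<n → P⇔Q x (<-trans x<n (n<1+n n))
  ... | yes Pn | no ¬Qn = ⊥-elim (¬Qn (Equivalence.to (P⇔Q n (n<1+n n)) Pn))
  ... | no ¬Pn | yes Qn = ⊥-elim (¬Pn (Equivalence.from (P⇔Q n (n<1+n n)) Qn))

module _ {P : ℕ → Set} (P? : ∀ x → Dec (P x)) where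

  count-+ : ∀ a b → count (a + b) P P? ≡ count a P P? + count b (λ x → P (a + x)) (λ x → P? (a + x))
  count-+ a zero    = trans (cong (λ n → count n P P?) (+-identityʳ a)) (sym (+-identityʳ _))
  count-+ a (suc b) rewrite +-suc a b with P? (a + b)
  ... | yes _ = trans (cong suc (count-+ a b)) (sym (+-suc _ _))
  ... | no  _ = count-+ a b

  count-none : ∀ n → (∀ x → ¬ P x) → count n P P? ≡ 0
  count-none zero    _  = refl
  count-none (suc n) ¬P with P? n
  ... | yes Pn = ⊥-elim (¬P n Pn)
  ... | no  _  = count-none n ¬P

  count-all : ∀ n → (∀ x → P x) → count n P P? ≡ n
  count-all zero    _   = refl
  count-all (suc n) all with P? n
  ... | yes _  = cong suc (count-all n all)
  ... | no ¬Pn = ⊥-elim (¬Pn (all n))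

module _ {p : ℕ} {f g : ℕ → ℕ} (f≡νg : f ≡ν[ p ] g) where

  Z-≡ν : ∀ τ → Z τ f ≡ Z τ g
  Z-≡ν τ = count-cong _ _ τ λ x _ → proj₁ (f≡νg x)

  Π-≡ν : ∀ i τ → Π p i τ f ≡ Π p i τ g
  Π-≡ν i τ = count-cong _ _ τ λ x _ → mk⇔
    (λ (fx≢0 , v) → (λ gx≡0 → fx≢0 (Equivalence.from (proj₁ (f≡νg x)) gx≡0)) , Equivalence.to (proj₂ (f≡νg x) fx≢0 i) v)
    (λ (gx≢0 , v) → let fx≢0 = λ fx≡0 → gx≢0 (Equivalence.to (proj₁ (f≡νg x)) fx≡0)
                    in fx≢0 , Equivalence.from (proj₂ (f≡νg x) fx≢0 i) v)

module BlockCounts {p : ℕ} .{{_ : NonZero p}} (t : ℕ) (g : ℕ → ℕ) where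

  open BlockOperator t g

  module _ {Φ : ℕ → Set} (Φ? : ∀ v → Dec (Φ v)) where

    one-block : ∀ Q → count (p ^ suc t) (λ r → Φ (A p t g (Q * p ^ suc t + r))) (λ r → Φ? (A p t g (Q * p ^ suc t + r)))
              ≡ count zeros (λ _ → Φ 0) (λ _ → Φ? 0) + count (p ^ t) (λ x → Φ (g (Q * p ^ t + x))) (λ x → Φ? (g (Q * p ^ t + x)))
    one-block Q =
      trans (cong (λ n → count n (λ r → Φ (A p t g (Q * p ^ suc t + r))) (λ r → Φ? (A p t g (Q * p ^ suc t + r)))) p^[1+t]≡zeros+p^t)
      (trans (count-+ (λ r → Φ? (A p t g (Q * p ^ suc t + r))) zeros (p ^ t))
             (cong₂ _+_ (count-cong _ _ zeros λ r r< → value-⇔ (A-zeros Q r r<))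
                        (count-cong _ _ (p ^ t) λ x x< → value-⇔ (A-copy Q x x<))))
      where
      value-⇔ : ∀ {u v} → u ≡ v → Φ u ⇔ Φ v
      value-⇔ refl = mk⇔ (λ z → z) (λ z → z)

    count-A : ∀ Q → count (Q * p ^ suc t) (λ x → Φ (A p t g x)) (λ x → Φ? (A p t g x))
                  ≡ count (Q * p ^ t) (λ x → Φ (g x)) (λ x → Φ? (g x)) + Q * count zeros (λ _ → Φ 0) (λ _ → Φ? 0)
    count-A zero    = refl
    count-A (suc Q) = begin
        count (suc Q * p ^ suc t) _ _
          ≡⟨ cong (λ n → count n (λ x → Φ (A p t g x)) (λ x → Φ? (A p t g x))) (+-comm (p ^ suc t) (Q * p ^ suc t)) ⟩
        count (Q * p ^ suc t + p ^ suc t) _ _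
          ≡⟨ count-+ (λ x → Φ? (A p t g x)) (Q * p ^ suc t) (p ^ suc t) ⟩
        count (Q * p ^ suc t) _ _ + count (p ^ suc t) _ _
          ≡⟨ cong₂ _+_ (count-A Q) (one-block Q) ⟩
        (countg (Q * p ^ t) + Q * Z₀) + (Z₀ + count (p ^ t) (λ x → Φ (g (Q * p ^ t + x))) (λ x → Φ? (g (Q * p ^ t + x))))
          ≡⟨ regroup (countg (Q * p ^ t)) (Q * Z₀) Z₀ _ ⟩
        (countg (Q * p ^ t) + count (p ^ t) (λ x → Φ (g (Q * p ^ t + x))) (λ x → Φ? (g (Q * p ^ t + x)))) + (Z₀ + Q * Z₀)
          ≡⟨ cong (_+ (Z₀ + Q * Z₀)) (sym (count-+ (λ x → Φ? (g x)) (Q * p ^ t) (p ^ t))) ⟩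
        countg (Q * p ^ t + p ^ t) + suc Q * Z₀
          ≡⟨ cong (λ n → countg n + suc Q * Z₀) (+-comm (Q * p ^ t) (p ^ t)) ⟩
        countg (suc Q * p ^ t) + suc Q * Z₀ ∎
      where
      open ≡-Reasoning
      Z₀ = count zeros (λ _ → Φ 0) (λ _ → Φ? 0)
      countg : ℕ → ℕ
      countg n = count n (λ x → Φ (g x)) (λ x → Φ? (g x))
      regroup : ∀ a b c d → (a + b) + (c + d) ≡ (a + d) + (c + b)
      regroup = solve-∀

  Z-A : ∀ Q → Z (Q * p ^ suc t) (A p t g) ≡ Z (Q * p ^ t) g + Q * zeros
  Z-A Q = trans (count-A (_≟ 0) Q) (cong (λ z → Z (Q * p ^ t) g + Q * z) (count-all (λ _ → 0 ≟ 0) zeros (λ _ → refl)))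

  Π-A : ∀ i Q → Π p i (Q * p ^ suc t) (A p t g) ≡ Π p i (Q * p ^ t) g
  Π-A i Q = trans (count-A (λ v → ¬? (v ≟ 0) ×-dec hasVal? p i v) Q)
    (trans (cong (λ z → Π p i (Q * p ^ t) g + Q * z) (count-none (λ _ → ¬? (0 ≟ 0) ×-dec hasVal? p i 0) zeros (λ _ (0≢0 , _) → 0≢0 refl)))
           (trans (cong (Π p i (Q * p ^ t) g +_) (*-zeroʳ Q)) (+-identityʳ _)))

module BinomialRows {p : ℕ} (p-prime : Prime p) where

  open Valuation p-prime
  open BinomialCarries p-prime
  open BinomialPeriod p-prime
  open Agreement p-prime

  bin-≡ν-A : ∀ t {Lo} (Lo< : Lo < p ^ t) l H →
    let open Spliced t Lo< l H in bin p (suc l) s ≡ν[ p ] A p t (bin p (suc l) s′)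
  bin-≡ν-A t Lo< l H n with BlockOperator.A-view {p = p} t (bin p (suc l) s′) n
    where open Spliced t Lo< l H
  ... | inj₁ (R , a , Q , R< , a< , refl , A≡0) =
    ≈ν-respʳ (Agree⇒≈ν (suc l) (both-divisible (p^∣C-digit<p∸1 Q R< a<) ((p ^ suc l) ∣0)))
             (trans (mod-zero (suc l) ((p ^ suc l) ∣0)) (sym A≡0))
    where open Spliced t Lo< l H
  ... | inj₂ (R , Q , R< , refl , A≡) = ≈ν-respʳ (Agree⇒≈ν (suc l) (agree-digit-p∸1 Q R<)) (sym A≡)
    where open Spliced t Lo< l H

  spliced-counts : ∀ t e l k H {Lo} (Lo< : Lo < p ^ t) {s s′} → k ≡ suc t + e →
    s ≡ Spliced.s t Lo< l H → s′ ≡ Spliced.s′ t Lo< l H → p ^ k ≤ s → s < p ^ (k + 1) →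
    ∀ τ τ′ → IsMinPeriod (bin p (suc l) s) τ → IsMinPeriod (bin p (suc l) s′) τ′ →
      (∀ i → Π p i τ (bin p (suc l) s) ≡ Π p i τ′ (bin p (suc l) s′))
    × (Z τ (bin p (suc l) s) ≡ Z τ′ (bin p (suc l) s′) + (p ∸ 1) * p ^ (k + suc l ∸ 1))
  spliced-counts t e l .(suc t + e) H Lo< refl refl refl p^k≤s s< τ τ′ τ-min τ′-min = Π-eq , Z-eq
    where
    open Spliced t Lo< l H
    open BlockCounts {p = p} t (bin p (suc l) s′)
    f≡νAg = bin-≡ν-A t Lo< l H
    Q = p ^ (suc e + l)
    s<p^ : s < p ^ (suc t + suc e)
    s<p^ = subst (λ z → s < p ^ z) (trans (+-comm _ 1) (sym (+-suc (suc t) e))) s<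
    bounds = s′-bounds e p^k≤s s<p^
    regroup : ∀ t e l → suc (suc t + e) + l ≡ suc t + (suc e + l)
    regroup = solve-∀
    regroup′ : ∀ t e l → suc (t + e) + l ≡ t + (suc e + l)
    regroup′ = solve-∀
    τ≡ : τ ≡ Q * p ^ suc t
    τ≡ = trans (bin-minimal-period (suc t + e) l s τ p^k≤s (subst (s <_) (cong (p ^_) (+-comm (suc t + e) 1)) s<) τ-min)
               (trans (cong (p ^_) (regroup t e l)) (p^[a+b]≡p^b*p^a (suc t) (suc e + l)))
    τ′≡ : τ′ ≡ Q * p ^ t
    τ′≡ = trans (bin-minimal-period (t + e) l s′ τ′ (proj₁ bounds) (proj₂ bounds) τ′-min)
                (trans (cong (p ^_) (regroup′ t e l)) (p^[a+b]≡p^b*p^a t (suc e + l)))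
    Π-eq : ∀ i → Π p i τ (bin p (suc l) s) ≡ Π p i τ′ (bin p (suc l) s′)
    Π-eq i = begin
      Π p i τ (bin p (suc l) s)                          ≡⟨ Π-≡ν f≡νAg i τ ⟩
      Π p i τ (A p t (bin p (suc l) s′))                 ≡⟨ cong (λ n → Π p i n (A p t (bin p (suc l) s′))) τ≡ ⟩
      Π p i (Q * p ^ suc t) (A p t (bin p (suc l) s′))   ≡⟨ Π-A i Q ⟩
      Π p i (Q * p ^ t) (bin p (suc l) s′)               ≡⟨ cong (λ n → Π p i n (bin p (suc l) s′)) (sym τ′≡) ⟩
      Π p i τ′ (bin p (suc l) s′)                        ∎
      where open ≡-Reasoning
    exponent : ∀ t e l → suc e + l + t ≡ suc t + e + suc l ∸ 1
    exponent t e l = trans (solve-∀-form t e l) (cong (_∸ 1) (sym (+-suc (suc t + e) l)))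
      where
      solve-∀-form : ∀ t e l → suc e + l + t ≡ suc t + e + l
      solve-∀-form = solve-∀
    zeros≡ : Q * ((p ∸ 1) * p ^ t) ≡ (p ∸ 1) * p ^ (suc t + e + suc l ∸ 1)
    zeros≡ = begin
      Q * ((p ∸ 1) * p ^ t)              ≡⟨ exchange Q (p ∸ 1) (p ^ t) ⟩
      (p ∸ 1) * (Q * p ^ t)              ≡⟨ cong ((p ∸ 1) *_) (sym (^-distribˡ-+-* p (suc e + l) t)) ⟩
      (p ∸ 1) * p ^ (suc e + l + t)      ≡⟨ cong (λ z → (p ∸ 1) * p ^ z) (exponent t e l) ⟩
      (p ∸ 1) * p ^ (suc t + e + suc l ∸ 1) ∎
      where
      open ≡-Reasoning
      exchange : ∀ a b c → a * (b * c) ≡ b * (a * c)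
      exchange = solve-∀
    Z-eq : Z τ (bin p (suc l) s) ≡ Z τ′ (bin p (suc l) s′) + (p ∸ 1) * p ^ (suc t + e + suc l ∸ 1)
    Z-eq = begin
      Z τ (bin p (suc l) s)
        ≡⟨ Z-≡ν f≡νAg τ ⟩
      Z τ (A p t (bin p (suc l) s′))
        ≡⟨ cong (λ n → Z n (A p t (bin p (suc l) s′))) τ≡ ⟩
      Z (Q * p ^ suc t) (A p t (bin p (suc l) s′))
        ≡⟨ Z-A Q ⟩
      Z (Q * p ^ t) (bin p (suc l) s′) + Q * ((p ∸ 1) * p ^ t)
        ≡⟨ cong₂ _+_ (cong (λ n → Z n (bin p (suc l) s′)) (sym τ′≡)) zeros≡ ⟩
      Z τ′ (bin p (suc l) s′) + (p ∸ 1) * p ^ (suc t + e + suc l ∸ 1) ∎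
      where open ≡-Reasoning

module DigitLists {p : ℕ} (p-prime : Prime p) where

  open Valuation p-prime using (p≢0)
  open Carries p-prime using (maxDigits; 1+maxDigits)

  ⌊⌋-foldl : ∀ ds acc → foldl (λ acc a → acc * p + a) acc ds ≡ acc * p ^ length ds + ⌊ ds ⌋ p
  ⌊⌋-foldl []       acc = sym (trans (+-identityʳ _) (*-identityʳ acc))
  ⌊⌋-foldl (d ∷ ds) acc = begin
      foldl (λ acc a → acc * p + a) (acc * p + d) ds
        ≡⟨ ⌊⌋-foldl ds (acc * p + d) ⟩
      (acc * p + d) * p ^ length ds + ⌊ ds ⌋ p
        ≡⟨ regroup p acc d (p ^ length ds) (⌊ ds ⌋ p) ⟩
      acc * p ^ suc (length ds) + (d * p ^ length ds + ⌊ ds ⌋ p)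
        ≡⟨ cong (acc * p ^ suc (length ds) +_) (sym (⌊⌋-foldl ds d)) ⟩
      acc * p ^ suc (length ds) + ⌊ d ∷ ds ⌋ p ∎
    where
    open ≡-Reasoning
    regroup : ∀ p acc d P X → (acc * p + d) * P + X ≡ acc * (p * P) + (d * P + X)
    regroup = solve-∀

  ⌊++⌋ : ∀ xs ys → ⌊ xs ++ ys ⌋ p ≡ ⌊ xs ⌋ p * p ^ length ys + ⌊ ys ⌋ p
  ⌊++⌋ xs ys = trans (foldl-++ (λ acc a → acc * p + a) 0 xs ys) (⌊⌋-foldl ys (⌊ xs ⌋ p))

  ⌊⌋<p^length : ∀ ds → All (_< p) ds → ⌊ ds ⌋ p < p ^ length ds
  ⌊⌋<p^length []       []           = s≤s z≤n
  ⌊⌋<p^length (d ∷ ds) (d<p ∷ ds<p) = begin-strict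
      ⌊ d ∷ ds ⌋ p                 ≡⟨ ⌊⌋-foldl ds d ⟩
      d * p ^ length ds + ⌊ ds ⌋ p <⟨ +-monoʳ-< (d * p ^ length ds) (⌊⌋<p^length ds ds<p) ⟩
      d * p ^ length ds + p ^ length ds ≡⟨ +-comm (d * p ^ length ds) (p ^ length ds) ⟩
      suc d * p ^ length ds        ≤⟨ *-monoˡ-≤ (p ^ length ds) d<p ⟩
      p ^ suc (length ds)          ∎
    where open ≤-Reasoning

  ⌊replicate⌋ : ∀ j → ⌊ replicate j (p ∸ 1) ⌋ p ≡ maxDigits j
  ⌊replicate⌋ zero    = refl
  ⌊replicate⌋ (suc j) = suc-injective (begin
      suc (⌊ replicate (suc j) (p ∸ 1) ⌋ p)
        ≡⟨ cong suc (⌊⌋-foldl (replicate j (p ∸ 1)) (p ∸ 1)) ⟩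
      suc ((p ∸ 1) * p ^ length (replicate j (p ∸ 1)) + ⌊ replicate j (p ∸ 1) ⌋ p)
        ≡⟨ cong₂ (λ n x → suc ((p ∸ 1) * p ^ n + x)) (length-replicate j) (⌊replicate⌋ j) ⟩
      suc ((p ∸ 1) * p ^ j + maxDigits j)
        ≡⟨ sym (+-suc _ (maxDigits j)) ⟩
      (p ∸ 1) * p ^ j + suc (maxDigits j)
        ≡⟨ cong ((p ∸ 1) * p ^ j +_) (1+maxDigits j) ⟩
      (p ∸ 1) * p ^ j + p ^ j
        ≡⟨ +-comm ((p ∸ 1) * p ^ j) (p ^ j) ⟩
      suc (p ∸ 1) * p ^ j
        ≡⟨ cong (_* p ^ j) (suc-pred p) ⟩
      p ^ suc j
        ≡⟨ sym (1+maxDigits (suc j)) ⟩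
      suc (maxDigits (suc j)) ∎)
    where open ≡-Reasoning

  ⌊spliced⌋ : ∀ hi j lo →
    ⌊ hi ++ replicate j (p ∸ 1) ++ lo ⌋ p ≡ ⌊ lo ⌋ p + (maxDigits j + ⌊ hi ⌋ p * p ^ j) * p ^ length lo
  ⌊spliced⌋ hi j lo = begin
      ⌊ hi ++ nines ++ lo ⌋ p
        ≡⟨ ⌊++⌋ hi (nines ++ lo) ⟩
      H * p ^ length (nines ++ lo) + ⌊ nines ++ lo ⌋ p
        ≡⟨ cong₂ (λ n x → H * p ^ n + x) length≡ (⌊++⌋ nines lo) ⟩
      H * p ^ (j + length lo) + (⌊ nines ⌋ p * p ^ length lo + Lo)
        ≡⟨ cong₂ (λ u v → H * u + (v * p ^ length lo + Lo)) (^-distribˡ-+-* p j (length lo)) (⌊replicate⌋ j) ⟩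
      H * (p ^ j * p ^ length lo) + (maxDigits j * p ^ length lo + Lo)
        ≡⟨ regroup H (p ^ j) (p ^ length lo) (maxDigits j) Lo ⟩
      Lo + (maxDigits j + H * p ^ j) * p ^ length lo ∎
    where
    open ≡-Reasoning
    nines = replicate j (p ∸ 1)
    H = ⌊ hi ⌋ p
    Lo = ⌊ lo ⌋ p
    length≡ : length (nines ++ lo) ≡ j + length lo
    length≡ = trans (length-++ nines) (cong (_+ length lo) (length-replicate j))
    regroup : ∀ H A B o Lo → H * (A * B) + (o * B + Lo) ≡ Lo + (o + H * A) * B
    regroup = solve-∀

k∸m∸l+[m+l]≡k : ∀ k m l → m + l ≤ k → k ∸ m ∸ l + (m + l) ≡ k
k∸m∸l+[m+l]≡k k m l m+l≤k = trans (cong (_+ (m + l)) (∸-+-assoc k m l)) (m∸n+n≡m m+l≤k)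

lemma4p6 : (p ℓ k m : ℕ) → Prime p → 1 ≤ ℓ → ℓ < k → m + ℓ + 1 ≤ k →
    (hi lo : List ℕ) → length hi ≡ m + 1 → length lo ≡ k ∸ m ∸ ℓ →
    All (_< p) hi → All (_< p) lo →
    p ^ k ≤ ⌊ hi ++ replicate ℓ (p ∸ 1) ++ lo ⌋ p →
    ⌊ hi ++ replicate ℓ (p ∸ 1) ++ lo ⌋ p < p ^ (k + 1) →
    (bin p ℓ (⌊ hi ++ replicate ℓ (p ∸ 1) ++ lo ⌋ p)
       ≡ν[ p ] A p (k ∸ m ∸ ℓ) (bin p ℓ (⌊ hi ++ replicate (ℓ ∸ 1) (p ∸ 1) ++ lo ⌋ p)))
    × (∀ τ τ′ → IsMinPeriod (bin p ℓ (⌊ hi ++ replicate ℓ (p ∸ 1) ++ lo ⌋ p)) τ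
              → IsMinPeriod (bin p ℓ (⌊ hi ++ replicate (ℓ ∸ 1) (p ∸ 1) ++ lo ⌋ p)) τ′
              → (∀ i → i < ℓ → Π p i τ (bin p ℓ (⌊ hi ++ replicate ℓ (p ∸ 1) ++ lo ⌋ p))
                                ≡ Π p i τ′ (bin p ℓ (⌊ hi ++ replicate (ℓ ∸ 1) (p ∸ 1) ++ lo ⌋ p)))
                × (Z τ (bin p ℓ (⌊ hi ++ replicate ℓ (p ∸ 1) ++ lo ⌋ p))
                   ≡ Z τ′ (bin p ℓ (⌊ hi ++ replicate (ℓ ∸ 1) (p ∸ 1) ++ lo ⌋ p))
                     + (p ∸ 1) * p ^ (k + ℓ ∸ 1)))
lemma4p6 p zero    k m p-prime () _ _ hi lo _ _ _ _ _ _
lemma4p6 p (suc l) k m p-prime _ _ m+ℓ+1≤k hi lo _ |lo|≡t _ lo<p p^k≤s s<p^[k+1] =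
    subst₂ (λ a b → bin p (suc l) a ≡ν[ p ] A p t (bin p (suc l) b)) (sym s≡) (sym s′≡) (bin-≡ν-A t Lo< l H)
  , λ τ τ′ τ-min τ′-min → map₁ (λ Π-eq i _ → Π-eq i)
      (spliced-counts t (m + l) l k H Lo< k≡ s≡ s′≡ p^k≤s s<p^[k+1] τ τ′ τ-min τ′-min)
  where
  open Carries p-prime using (maxDigits-shift)
  open BinomialCarries p-prime using (module Spliced)
  open BinomialRows p-prime using (bin-≡ν-A; spliced-counts)
  open DigitLists p-prime using (⌊⌋<p^length; ⌊spliced⌋)
  t = k ∸ m ∸ suc l
  H = ⌊ hi ⌋ p
  Lo = ⌊ lo ⌋ p
  Lo< : Lo < p ^ t
  Lo< = subst (λ n → Lo < p ^ n) |lo|≡t (⌊⌋<p^length lo lo<p)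
  open Spliced t Lo< l H using (S′; s; s′)
  s≡ : ⌊ hi ++ replicate (suc l) (p ∸ 1) ++ lo ⌋ p ≡ s
  s≡ = trans (⌊spliced⌋ hi (suc l) lo) (cong₂ (λ S n → Lo + S * p ^ n) (maxDigits-shift l H) |lo|≡t)
  s′≡ : ⌊ hi ++ replicate l (p ∸ 1) ++ lo ⌋ p ≡ s′
  s′≡ = trans (⌊spliced⌋ hi l lo) (cong (λ n → Lo + S′ * p ^ n) |lo|≡t)
  regroup : ∀ t m l → suc t + (m + l) ≡ t + (m + suc l)
  regroup = solve-∀
  k≡ : k ≡ suc t + (m + l)
  k≡ = sym (trans (regroup t m l) (k∸m∸l+[m+l]≡k k m (suc l) (≤-trans (m≤m+n (m + suc l) 1) m+ℓ+1≤k)))
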